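{- Let $p$ be an odd prime and $k \ge 1$ an integer, and let $n=p^k$. Then $t(n) \ge n-k-1 = n-\log_p n - 1$.
   Context: A cyclic permutation of order $n$ is a bijective labeling of the vertices of a cycle of length $n$ by the elements of $[n]$, up to rotation of the cycle (reflections are not identified). A swap exchanges the labels of any two (not necessarily adjacent) vertices. $t(n)$ is the maximum, over all cyclic permutations of order $n$, of the minimum number of swaps needed to transform it into the trivial cyclic permutation $(1,2,\ldots,n)$ (labels $1,\ldots,n$ consecutively in order around the cycle). Equivalently, with $c=(1,2,\ldots,n)\in S_n$, $C_n=\langle c\rangle$ and $\operatorname{cyc}(\sigma)$ the number of cycles of $\sigma\in S_n$ (fixed points included), $t(n)=\max_{\pi\in S_n}\min_{\sigma\in\pi C_n}(n-\operatorname{cyc}(\sigma))$. -}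

module Defs where

open import Data.Nat using (ℕ; zero; suc; _+_; _≤_; _≤?_)
open import Data.Nat.DivMod using (_mod_)
open import Data.Fin using (Fin; toℕ)
open import Data.Fin.Permutation using (Permutation′; _⟨$⟩ʳ_)
open import Data.List using (List; length; filter)
open import Data.List.Relation.Unary.All using (All; all?)
open import Data.List using (allFin; upTo; map)
open import Relation.Nullary.Decidable using (Dec)

iter : {A : Set} → (A → A) → ℕ → A → A
iter f zero    x = x
iter f (suc m) x = f (iter f m x)

-- An element i is the least element (in the usual order of Fin n) of its
-- σ-orbit {σ^m i | m < n} (every orbit of a permutation on
-- Fin n is reached within n steps).
isOrbitMin : ∀ {n} → (Fin n → Fin n) → Fin n → Set
isOrbitMin {n} σ i = All (λ m → toℕ i ≤ toℕ (iter σ m i)) (upTo n)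

isOrbitMin? : ∀ {n} (σ : Fin n → Fin n) (i : Fin n) → Dec (isOrbitMin σ i)
isOrbitMin? {n} σ i = all? (λ m → toℕ i ≤? toℕ (iter σ m i)) (upTo n)

-- cyc(σ): number of cycles of the permutation σ (fixed points included),
-- counted as the number of orbits, i.e. the number of orbit-minima.
cyc : ∀ {n} → (Fin n → Fin n) → ℕ
cyc {n} σ = length (filter (isOrbitMin? σ) (allFin n))

-- c^j where c = (1 2 ... n) is the cyclic shift x ↦ x + 1 (mod n)
-- (labels 0..n-1 instead of 1..n).
cpow : ∀ n → ℕ → Fin n → Fin n
cpow (suc m) j x = (toℕ x + j) mod (suc m)

cosetElem : ∀ {n} → Permutation′ n → ℕ → Fin n → Fin n
cosetElem {n} π j x = π ⟨$⟩ʳ cpow n j x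

-- "t(n) ≥ m", unfolding t(n) = max_π min_{σ ∈ π C_n} (n - cyc σ):
-- some π has every coset element σ = π c^j (0 ≤ j < n) with n - cyc σ ≥ m.
t≥ : ℕ → ℕ → Set
t≥ n m = Σ (Permutation′ n) (λ π → (j : Fin n) → m ≤ n ∸ cyc (cosetElem π (toℕ j)))
  where open import Data.Product using (Σ)
        open import Data.Nat using (_∸_)

{-# OPTIONS --safe #-}
module Submission where

-- Let a be a primitive root modulo n = p ^ k (it exists since p is odd) and π the permutation
-- x ↦ a x of ℤ/nℤ. An element σ = π c ^ j of the coset π Cₙ is x ↦ a (x + j), and the affine
-- bijection L x = (a - 1) x + a j (a ≢ 1 modulo p) conjugates σ to multiplication by a. As a
-- generates the units modulo every p ^ (k - e), multiplication by a permutes transitively the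
-- residues of each valuation e = 0, …, k, so σ has at most k + 1 cycles.
--
-- The primitive root modulo p is an element of maximal order M: every unit then satisfies
-- x ^ M ≡ 1, and Lagrange's bound for x ^ M - 1 forces all units to be powers of it. Choosing
-- it with a ^ M ≢ 1 modulo p², the powers a ^ (M p ^ j) ≡ 1 + p ^ (j + 1) T with p ∤ T reach
-- every unit modulo p ^ k, digit by digit.

module LowerBound where

  open import Defs

  open import Data.Fin as Fin using (Fin; toℕ; fromℕ<)
  import Data.Fin.Properties as Finₚ
  open import Data.Fin.Permutation using (Permutation′; permutation)
  open import Data.Integer as ℤ using (ℤ; +_; _+_; _*_; _-_; -_; _^_; 0ℤ; 1ℤ; -1ℤ; _%ℕ_; _/ℕ_)
  import Data.Integer.DivMod as ℤDivMod
  open import Data.Integer.Divisibility.Signed as ℤ∣ using (_∣_; divides)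
  import Data.Integer.Properties as ℤₚ
  open import Data.Integer.Tactic.RingSolver using (solve-∀)
  open import Data.List as List using (List; []; _∷_; length; upTo; applyUpTo; allFin)
  open import Data.List.Extrema.Nat using (argmax; f[xs]≤f[argmax]; f[⊥]≤f[argmax])
  open import Data.List.Membership.Propositional.Properties using (∈-upTo⁺; ∈-lookup)
  open import Data.List.Properties using (length-applyUpTo)
  open import Data.List.Relation.Unary.All as All using (All; []; _∷_)
  import Data.List.Relation.Unary.All.Properties as Allₚ
  open import Data.List.Relation.Unary.AllPairs using (AllPairs; []; _∷_)
  import Data.List.Relation.Unary.AllPairs.Properties as AllPairsₚ
  import Data.List.Relation.Unary.Unique.Propositional.Properties as Uniqueₚ
  open import Data.Nat as ℕ using (ℕ; zero; suc; z≤n; s≤s; _≤_; _<_; _∸_; NonZero; nonTrivial⇒≢1)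
  open import Data.Nat.Combinatorics using (_C_; nC1≡n; nCk+nC[k+1]≡[n+1]C[k+1])
  open import Data.Nat.Coprimality as Coprimality using (Coprime; coprime-divisor)
  import Data.Nat.Divisibility as ℕ∣
  open import Data.Nat.DivMod as ℕDivMod using (_mod_)
  open import Data.Nat.GCD using (gcd; gcd[m,n]∣m; gcd[m,n]∣n; gcd-greatest)
  open import Data.Nat.Induction using (<-rec)
  open import Data.Nat.ListAction using (product)
  open import Data.Nat.Primality
    using (Prime; euclidsLemma; prime⇒nonZero; prime⇒nonTrivial; prime⇒irreducible)
  open import Data.Nat.Primality.Factorisation using (factorise)
  import Data.Nat.Properties as ℕₚ
  open import Data.Product using (∃; ∃-syntax; _×_; _,_; proj₁; proj₂)
  open import Data.Sum using (_⊎_; inj₁; inj₂; [_,_]′)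
  open import Data.Vec as Vec using (Vec; []; _∷_)
  open import Function using (_∘_; id)
  open import Level using (0ℓ)
  open import Relation.Binary using (Setoid; IsEquivalence)
  import Relation.Binary.Reasoning.Setoid as SetoidReasoning
  open import Relation.Binary.PropositionalEquality
  open import Relation.Nullary using (¬_; Dec; yes; no; contradiction; _×-dec_)
  import Relation.Nullary.Decidable as Dec
  import Relation.Unary as U

  ∤⇒coprime : ∀ {p m} → Prime p → ¬ p ℕ∣.∣ m → Coprime m p
  ∤⇒coprime p-prime p∤m (d∣m , d∣p) with prime⇒irreducible p-prime d∣p
  ... | inj₁ d≡1  = d≡1
  ... | inj₂ refl = contradiction d∣m p∤m

  coprime-*ʳ : ∀ {m n o} → Coprime m n → Coprime m o → Coprime m (n ℕ.* o)
  coprime-*ʳ m⊥n m⊥o (d∣m , d∣no) =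
    m⊥o (d∣m , coprime-divisor (λ (e∣d , e∣n) → m⊥n (ℕ∣.∣-trans e∣d d∣m , e∣n)) d∣no)

  coprime-^ʳ : ∀ {m n} → Coprime m n → ∀ k → Coprime m (n ℕ.^ k)
  coprime-^ʳ m⊥n zero    (_ , d∣1) = ℕ∣.∣1⇒≡1 d∣1
  coprime-^ʳ m⊥n (suc k) = coprime-*ʳ m⊥n (coprime-^ʳ m⊥n k)

  coprime-*-∣ : ∀ {m n t} → Coprime m n → m ℕ∣.∣ t → n ℕ∣.∣ t → m ℕ.* n ℕ∣.∣ t
  coprime-*-∣ {m} {n} m⊥n (ℕ∣.divides s refl) n∣sm = subst (m ℕ.* n ℕ∣.∣_) (ℕₚ.*-comm m s)
    (ℕ∣.*-monoʳ-∣ m (coprime-divisor (Coprimality.sym m⊥n) (subst (n ℕ∣.∣_) (ℕₚ.*-comm s m) n∣sm)))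

  prime>1 : ∀ {q} → Prime q → 1 < q
  prime>1 {q} q-prime = ℕ.nonTrivial⇒n>1 q ⦃ prime⇒nonTrivial q-prime ⦄

  prime-factor : ∀ {h} → 1 < h → ∃[ q ] Prime q × q ℕ∣.∣ h
  prime-factor {h} 1<h with factorise h ⦃ ℕ.>-nonZero (ℕₚ.<-trans ℕ.z<s 1<h) ⦄
  ... | record { factors = [] ; isFactorisation = h≡1 } = contradiction h≡1 (ℕₚ.>⇒≢ 1<h)
  ... | record { factors = q ∷ qs ; isFactorisation = h≡q*qs ; factorsPrime = q-prime ∷ _ } =
    q , q-prime , ℕ∣.divides (product qs) (trans h≡q*qs (ℕₚ.*-comm q (product qs)))

  n<m^n : ∀ {m} n → 1 < m → n < m ℕ.^ n
  n<m^n zero    1<m = ℕ.z<s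
  n<m^n {m} (suc n) 1<m = begin-strict
    suc n                 <⟨ s≤s (n<m^n n 1<m) ⟩
    suc (m ℕ.^ n)         ≤⟨ ℕₚ.+-monoˡ-≤ (m ℕ.^ n) (ℕₚ.≤-trans (s≤s z≤n) (n<m^n n 1<m)) ⟩
    m ℕ.^ n ℕ.+ m ℕ.^ n   ≡⟨ cong (m ℕ.^ n ℕ.+_) (ℕₚ.+-identityʳ (m ℕ.^ n)) ⟨
    2 ℕ.* m ℕ.^ n         ≤⟨ ℕₚ.*-monoˡ-≤ (m ℕ.^ n) 1<m ⟩
    m ℕ.* m ℕ.^ n         ∎
    where open ℕₚ.≤-Reasoning

  IsCappedValuation : ℕ → ℕ → ℕ → ℕ → Set
  IsCappedValuation q k X e = e ≤ k × q ℕ.^ e ℕ∣.∣ X × (e < k → ¬ q ℕ.^ suc e ℕ∣.∣ X)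

  capped-valuation : ∀ q X k → ∃ (IsCappedValuation q k X)
  capped-valuation q X zero = 0 , z≤n , ℕ∣.1∣ X , λ ()
  capped-valuation q X (suc k) with capped-valuation q X k
  ... | e , e≤k , qᵉ∣X , maximal with ℕₚ.m≤n⇒m<n∨m≡n e≤k
  ...   | inj₁ e<k  = e , ℕₚ.m≤n⇒m≤1+n e≤k , qᵉ∣X , λ _ → maximal e<k
  ...   | inj₂ refl with q ℕ.^ suc e ℕ∣.∣? X
  ...     | yes qᵉ⁺¹∣X = suc e , ℕₚ.≤-refl , qᵉ⁺¹∣X , λ e<e → contradiction e<e (ℕₚ.<-irrefl refl)
  ...     | no  qᵉ⁺¹∤X = e , ℕₚ.n≤1+n e , qᵉ∣X , λ _ → qᵉ⁺¹∤X

  valuation : ∀ {q X} → 1 < q → 0 < X → ∃[ e ] q ℕ.^ e ℕ∣.∣ X × ¬ q ℕ.^ suc e ℕ∣.∣ X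
  valuation {q} {X} 1<q 0<X with capped-valuation q X X
  ... | e , e≤X , qᵉ∣X , maximal = e , qᵉ∣X , maximal e<X
    where
    e<X : e < X
    e<X = ℕₚ.≤∧≢⇒< e≤X λ { refl → ℕₚ.<⇒≱ (n<m^n X 1<q) (ℕ∣.∣⇒≤ ⦃ ℕ.>-nonZero 0<X ⦄ qᵉ∣X) }

  prime-power-∤ : ∀ {n M} → 0 < n → ¬ n ℕ∣.∣ M →
                  ∃[ q ] ∃[ e ] Prime q × q ℕ.^ e ℕ∣.∣ n × ¬ q ℕ.^ e ℕ∣.∣ M
  prime-power-∤ {n} {M} 0<n n∤M with gcd[m,n]∣m n M
  ... | ℕ∣.divides h n≡h*g with prime-factor (cofactor>1 h n≡h*g)
    where
    cofactor>1 : ∀ h → n ≡ h ℕ.* gcd n M → 1 < h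
    cofactor>1 0             n≡0 = contradiction n≡0 (ℕₚ.>⇒≢ 0<n)
    cofactor>1 1             n≡g = contradiction (subst (ℕ∣._∣ M) (sym (trans n≡g (ℕₚ.*-identityˡ _)))
                                                        (gcd[m,n]∣n n M)) n∤M
    cofactor>1 (suc (suc _)) _   = s≤s (s≤s z≤n)
  ...   | q , q-prime , q∣h with valuation (prime>1 q-prime) 0<n
  ...     | e , qᵉ∣n , qᵉ⁺¹∤n = q , e , q-prime , qᵉ∣n , λ qᵉ∣M →
    qᵉ⁺¹∤n (subst (q ℕ.^ suc e ℕ∣.∣_) (sym n≡h*g) (ℕ∣.*-pres-∣ q∣h (gcd-greatest qᵉ∣n qᵉ∣M)))

  module _ {P : ℕ → Set} (P? : U.Decidable P) where

    least-witness : ∀ {n} → P n → ∃[ m ] P m × (∀ {k} → k < m → ¬ P k)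
    least-witness {n} = <-rec (λ n → P n → ∃[ m ] P m × (∀ {k} → k < m → ¬ P k)) search n
      where
      search : ∀ n → (∀ {k} → k < n → P k → ∃[ m ] P m × (∀ {k} → k < m → ¬ P k)) →
               P n → ∃[ m ] P m × (∀ {k} → k < m → ¬ P k)
      search n smaller Pn with ℕₚ.anyUpTo? P? n
      ... | yes (k , k<n , Pk) = smaller k<n Pk
      ... | no none            = n , Pn , λ k<n Pk → none (_ , k<n , Pk)

  [1+n]C2*2≡[1+n]*n : ∀ n → (suc n C 2) ℕ.* 2 ≡ suc n ℕ.* n
  [1+n]C2*2≡[1+n]*n zero    = refl
  [1+n]C2*2≡[1+n]*n (suc n) = begin-equality
    (suc (suc n) C 2) ℕ.* 2               ≡⟨ cong (ℕ._* 2) (nCk+nC[k+1]≡[n+1]C[k+1] (suc n) 1) ⟨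
    ((suc n C 1) ℕ.+ (suc n C 2)) ℕ.* 2   ≡⟨ cong (λ c → (c ℕ.+ (suc n C 2)) ℕ.* 2) (nC1≡n (suc n)) ⟩
    (suc n ℕ.+ (suc n C 2)) ℕ.* 2         ≡⟨ ℕₚ.*-distribʳ-+ 2 (suc n) (suc n C 2) ⟩
    suc n ℕ.* 2 ℕ.+ (suc n C 2) ℕ.* 2     ≡⟨ cong (suc n ℕ.* 2 ℕ.+_) ([1+n]C2*2≡[1+n]*n n) ⟩
    suc n ℕ.* 2 ℕ.+ suc n ℕ.* n           ≡⟨ ℕₚ.*-distribˡ-+ (suc n) 2 n ⟨
    suc n ℕ.* (2 ℕ.+ n)                   ≡⟨ ℕₚ.*-comm (suc n) (suc (suc n)) ⟩
    suc (suc n) ℕ.* suc n                 ∎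
    where open ℕₚ.≤-Reasoning

  -- This is why the lifting of primitive roots needs p odd.
  [1+q*2]C2≡[1+q*2]*q : ∀ q → (suc (q ℕ.* 2) C 2) ≡ suc (q ℕ.* 2) ℕ.* q
  [1+q*2]C2≡[1+q*2]*q q = ℕₚ.*-cancelʳ-≡ _ _ 2
    (trans ([1+n]C2*2≡[1+n]*n (q ℕ.* 2)) (sym (ℕₚ.*-assoc (suc (q ℕ.* 2)) q 2)))

  odd-prime⇒p≡1+[p/2]*2 : ∀ {p} → Prime p → p ≢ 2 → p ≡ suc (p ℕ./ 2 ℕ.* 2)
  odd-prime⇒p≡1+[p/2]*2 {p} p-prime p≢2 with p ℕ.% 2 in p%2≡r | ℕDivMod.m%n<n p 2
  ... | 0           | _ = contradiction (prime⇒irreducible p-prime (ℕ∣.m%n≡0⇒n∣m p 2 p%2≡r)) [ (λ ()) , p≢2 ∘ sym ]′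
  ... | 1           | _ = trans (ℕDivMod.m≡m%n+[m/n]*n p 2) (cong (ℕ._+ p ℕ./ 2 ℕ.* 2) p%2≡r)
  ... | suc (suc _) | s≤s (s≤s ())

  -- Congruences of integers

  infix 4 _≡_[mod_]
  record _≡_[mod_] (a b m : ℤ) : Set where
    constructor mod-intro
    field
      quotient   : ℤ
      difference : a - b ≡ quotient * m
  open _≡_[mod_] using (quotient; difference)

  module _ {m : ℤ} where

    ≡mod-refl : ∀ {a} → a ≡ a [mod m ]
    ≡mod-refl {a} = mod-intro 0ℤ (ℤₚ.+-inverseʳ a)

    ≡mod-reflexive : ∀ {a b} → a ≡ b → a ≡ b [mod m ]
    ≡mod-reflexive refl = ≡mod-refl

    ≡mod-sym : ∀ {a b} → a ≡ b [mod m ] → b ≡ a [mod m ]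
    ≡mod-sym {a} {b} (mod-intro q eq) = mod-intro (- q) (begin
      b - a       ≡⟨ negate a b ⟩
      - (a - b)   ≡⟨ cong -_ eq ⟩
      - (q * m)   ≡⟨ ℤₚ.neg-distribˡ-* q m ⟩
      - q * m     ∎)
      where
      open ≡-Reasoning
      negate : ∀ a b → b - a ≡ - (a - b)
      negate = solve-∀

    ≡mod-trans : ∀ {a b c} → a ≡ b [mod m ] → b ≡ c [mod m ] → a ≡ c [mod m ]
    ≡mod-trans {a} {b} {c} (mod-intro q eq) (mod-intro r eq′) = mod-intro (q + r) (begin
      a - c               ≡⟨ telescope a b c ⟩
      (a - b) + (b - c)   ≡⟨ cong₂ _+_ eq eq′ ⟩
      q * m + r * m       ≡⟨ ℤₚ.*-distribʳ-+ m q r ⟨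
      (q + r) * m         ∎)
      where
      open ≡-Reasoning
      telescope : ∀ a b c → a - c ≡ (a - b) + (b - c)
      telescope = solve-∀

    +-cong-mod : ∀ {a b c d} → a ≡ b [mod m ] → c ≡ d [mod m ] → a + c ≡ b + d [mod m ]
    +-cong-mod {a} {b} {c} {d} (mod-intro q eq) (mod-intro r eq′) = mod-intro (q + r) (begin
      (a + c) - (b + d)   ≡⟨ regroup a b c d ⟩
      (a - b) + (c - d)   ≡⟨ cong₂ _+_ eq eq′ ⟩
      q * m + r * m       ≡⟨ ℤₚ.*-distribʳ-+ m q r ⟨
      (q + r) * m         ∎)
      where
      open ≡-Reasoning
      regroup : ∀ a b c d → (a + c) - (b + d) ≡ (a - b) + (c - d)
      regroup = solve-∀

    -‿cong-mod : ∀ {a b} → a ≡ b [mod m ] → - a ≡ - b [mod m ]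
    -‿cong-mod {a} {b} (mod-intro q eq) = mod-intro (- q) (begin
      - a - - b   ≡⟨ negate a b ⟩
      - (a - b)   ≡⟨ cong -_ eq ⟩
      - (q * m)   ≡⟨ ℤₚ.neg-distribˡ-* q m ⟩
      - q * m     ∎)
      where
      open ≡-Reasoning
      negate : ∀ a b → - a - - b ≡ - (a - b)
      negate = solve-∀

    +-cancelʳ-mod : ∀ {a b} c → a + c ≡ b + c [mod m ] → a ≡ b [mod m ]
    +-cancelʳ-mod {a} {b} c a+c≡b+c =
      subst₂ (_≡_[mod m ]) (cancel a c) (cancel b c) (+-cong-mod a+c≡b+c (≡mod-refl {a = - c}))
      where
      cancel : ∀ a c → a + c + - c ≡ a
      cancel = solve-∀

    *-congˡ-mod : ∀ c {a b} → a ≡ b [mod m ] → c * a ≡ c * b [mod m ]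
    *-congˡ-mod c {a} {b} (mod-intro q eq) = mod-intro (c * q) (begin
      c * a - c * b   ≡⟨ factor c a b ⟩
      c * (a - b)     ≡⟨ cong (c *_) eq ⟩
      c * (q * m)     ≡⟨ ℤₚ.*-assoc c q m ⟨
      c * q * m       ∎)
      where
      open ≡-Reasoning
      factor : ∀ c a b → c * a - c * b ≡ c * (a - b)
      factor = solve-∀

    *-congʳ-mod : ∀ c {a b} → a ≡ b [mod m ] → a * c ≡ b * c [mod m ]
    *-congʳ-mod c {a} {b} a≡b =
      subst₂ (_≡_[mod m ]) (ℤₚ.*-comm c a) (ℤₚ.*-comm c b) (*-congˡ-mod c a≡b)

    *-cong-mod : ∀ {a b c d} → a ≡ b [mod m ] → c ≡ d [mod m ] → a * c ≡ b * d [mod m ]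
    *-cong-mod {b = b} {c} a≡b c≡d = ≡mod-trans (*-congʳ-mod c a≡b) (*-congˡ-mod b c≡d)

    ^-cong-mod : ∀ {a b} n → a ≡ b [mod m ] → a ^ n ≡ b ^ n [mod m ]
    ^-cong-mod zero    a≡b = ≡mod-refl
    ^-cong-mod (suc n) a≡b = *-cong-mod a≡b (^-cong-mod n a≡b)

    ≡mod⇒∣ : ∀ {a b} → a ≡ b [mod m ] → m ∣ a - b
    ≡mod⇒∣ (mod-intro q eq) = divides q eq

    ∣⇒≡mod : ∀ {a b} → m ∣ a - b → a ≡ b [mod m ]
    ∣⇒≡mod (divides q eq) = mod-intro q eq

    ≡0-mod⇒∣ : ∀ {a} → a ≡ 0ℤ [mod m ] → m ∣ a
    ≡0-mod⇒∣ {a} a≡0 = subst (m ∣_) (ℤₚ.+-identityʳ a) (≡mod⇒∣ a≡0)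

    ∣⇒≡0-mod : ∀ {a} → m ∣ a → a ≡ 0ℤ [mod m ]
    ∣⇒≡0-mod {a} m∣a = ∣⇒≡mod (subst (m ∣_) (sym (ℤₚ.+-identityʳ a)) m∣a)

    ≡mod-isEquivalence : IsEquivalence (_≡_[mod m ])
    ≡mod-isEquivalence = record { refl = ≡mod-refl ; sym = ≡mod-sym ; trans = ≡mod-trans }

  ≡mod-setoid : ℤ → Setoid 0ℓ 0ℓ
  ≡mod-setoid m = record { isEquivalence = ≡mod-isEquivalence {m} }

  module ≡mod-Reasoning (m : ℤ) = SetoidReasoning (≡mod-setoid m)

  ≡mod-weaken : ∀ {a b m m′} → m ∣ m′ → a ≡ b [mod m′ ] → a ≡ b [mod m ]
  ≡mod-weaken m∣m′ a≡b = ∣⇒≡mod (ℤ∣.∣-trans m∣m′ (≡mod⇒∣ a≡b))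

  infix 4 _≡mod?_[_]
  _≡mod?_[_] : ∀ a b m → Dec (a ≡ b [mod m ])
  a ≡mod? b [ m ] = Dec.map′ ∣⇒≡mod ≡mod⇒∣ (m ℤ∣.∣? (a - b))

  quotient-form : ∀ {a b m} (a≡b : a ≡ b [mod m ]) → a ≡ b + quotient a≡b * m
  quotient-form {a} {b} (mod-intro q a-b≡qm) = trans (split a b) (cong (λ d → b + d) a-b≡qm)
    where
    split : ∀ a b → a ≡ b + (a - b)
    split = solve-∀

  +-multiple-≡mod : ∀ a q {m} → a + q * m ≡ a [mod m ]
  +-multiple-≡mod a q {m} = mod-intro q (cancel a (q * m))
    where
    cancel : ∀ a b → (a + b) - a ≡ b
    cancel = solve-∀

  ≡mod-%ℕ : ∀ a n .⦃ _ : NonZero n ⦄ → a ≡ + (a %ℕ n) [mod + n ]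
  ≡mod-%ℕ a n = subst (_≡ + (a %ℕ n) [mod + n ]) (sym (ℤDivMod.a≡a%ℕn+[a/ℕn]*n a n))
                      (+-multiple-≡mod (+ (a %ℕ n)) (a /ℕ n))

  *-cancelˡ-mod : ∀ {n u a b} → Coprime n ℤ.∣ u ∣ → u * a ≡ u * b [mod + n ] → a ≡ b [mod + n ]
  *-cancelˡ-mod {n} {u} {a} {b} n⊥u ua≡ub = ∣⇒≡mod (ℤ∣.∣ᵤ⇒∣ (coprime-divisor n⊥u n∣u[a-b]))
    where
    factor : ∀ c a b → c * a - c * b ≡ c * (a - b)
    factor = solve-∀
    n∣u[a-b] : n ℕ∣.∣ ℤ.∣ u ∣ ℕ.* ℤ.∣ a - b ∣
    n∣u[a-b] = subst (n ℕ∣.∣_) (trans (cong ℤ.∣_∣ (factor u a b)) (ℤₚ.abs-* u (a - b)))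
                     (ℤ∣.∣⇒∣ᵤ (≡mod⇒∣ ua≡ub))

  pos-*-factor : ∀ {Z} V m → Z ≡ V ℕ.* m → + Z ≡ + V * + m
  pos-*-factor V m refl = ℤₚ.pos-* V m

  pos-^ : ∀ m k → + (m ℕ.^ k) ≡ (+ m) ^ k
  pos-^ m zero    = refl
  pos-^ m (suc k) = trans (ℤₚ.pos-* m (m ℕ.^ k)) (cong (+ m *_) (pos-^ m k))

  ^-distribʳ-* : ∀ a b n → (a * b) ^ n ≡ a ^ n * b ^ n
  ^-distribʳ-* a b zero    = refl
  ^-distribʳ-* a b (suc n) =
    trans (cong ((a * b) *_) (^-distribʳ-* a b n)) (interchange a b (a ^ n) (b ^ n))
    where
    interchange : ∀ a b x y → (a * b) * (x * y) ≡ (a * x) * (b * y)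
    interchange = solve-∀

  module _ {m : ℤ} where

    ^-*-≡1-mod : ∀ {y} d q → y ^ d ≡ 1ℤ [mod m ] → y ^ (d ℕ.* q) ≡ 1ℤ [mod m ]
    ^-*-≡1-mod {y} d q yᵈ≡1 =
      subst₂ (_≡_[mod m ]) (ℤₚ.^-*-assoc y d q) (ℤₚ.^-zeroˡ q) (^-cong-mod q yᵈ≡1)

    ^-%-≡mod : ∀ {y} d t .⦃ _ : NonZero d ⦄ → y ^ d ≡ 1ℤ [mod m ] → y ^ t ≡ y ^ (t ℕ.% d) [mod m ]
    ^-%-≡mod {y} d t yᵈ≡1 = begin
      y ^ t                                    ≡⟨ cong (y ^_) (trans (ℕDivMod.m≡m%n+[m/n]*n t d)
                                                    (cong (t ℕ.% d ℕ.+_) (ℕₚ.*-comm (t ℕ./ d) d))) ⟩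
      y ^ (t ℕ.% d ℕ.+ d ℕ.* (t ℕ./ d))        ≡⟨ ℤₚ.^-distribˡ-+-* y (t ℕ.% d) (d ℕ.* (t ℕ./ d)) ⟩
      y ^ (t ℕ.% d) * y ^ (d ℕ.* (t ℕ./ d))    ≈⟨ *-congˡ-mod (y ^ (t ℕ.% d)) (^-*-≡1-mod d (t ℕ./ d) yᵈ≡1) ⟩
      y ^ (t ℕ.% d) * 1ℤ                       ≡⟨ ℤₚ.*-identityʳ (y ^ (t ℕ.% d)) ⟩
      y ^ (t ℕ.% d)                            ∎
      where open ≡mod-Reasoning m

  binomial-≡mod : ∀ x y n → (x + y) ^ suc n ≡ x ^ suc n + + suc n * x ^ n * y [mod y * y ]
  binomial-≡mod x y zero    = ≡mod-reflexive (first-order x y)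
    where
    first-order : ∀ x y → (x + y) * 1ℤ ≡ x * 1ℤ + + 1 * 1ℤ * y
    first-order = solve-∀
  binomial-≡mod x y (suc n) = begin
    (x + y) * (x + y) ^ suc n
      ≈⟨ *-congˡ-mod (x + y) (binomial-≡mod x y n) ⟩
    (x + y) * (x * x ^ n + + suc n * x ^ n * y)
      ≡⟨ expand x y (x ^ n) (+ suc n) ⟩
    x * (x * x ^ n) + (+ 1 + + suc n) * (x * x ^ n) * y + (+ suc n * x ^ n) * (y * y)
      ≈⟨ +-multiple-≡mod (x * (x * x ^ n) + (+ 1 + + suc n) * (x * x ^ n) * y) (+ suc n * x ^ n) ⟩
    x * (x * x ^ n) + + suc (suc n) * (x * x ^ n) * y
      ∎
    where
    open ≡mod-Reasoning (y * y)
    expand : ∀ x y X k → (x + y) * (x * X + k * X * y)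
                       ≡ x * (x * X) + (+ 1 + k) * (x * X) * y + (k * X) * (y * y)
    expand = solve-∀

  cubic-binomial-≡mod : ∀ y r → (1ℤ + y) ^ r ≡ 1ℤ + + r * y + + (r C 2) * (y * y) [mod y * y * y ]
  cubic-binomial-≡mod y zero    = ≡mod-reflexive (constant y)
    where
    constant : ∀ y → 1ℤ ≡ 1ℤ + 0ℤ * y + 0ℤ * (y * y)
    constant = solve-∀
  cubic-binomial-≡mod y (suc r) = begin
    (1ℤ + y) * (1ℤ + y) ^ r
      ≈⟨ *-congˡ-mod (1ℤ + y) (cubic-binomial-≡mod y r) ⟩
    (1ℤ + y) * (1ℤ + + r * y + + (r C 2) * (y * y))
      ≡⟨ expand y (+ r) (+ (r C 2)) ⟩
    1ℤ + (+ 1 + + r) * y + (+ r + + (r C 2)) * (y * y) + + (r C 2) * (y * y * y)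
      ≈⟨ +-multiple-≡mod (1ℤ + (+ 1 + + r) * y + (+ r + + (r C 2)) * (y * y)) (+ (r C 2)) ⟩
    1ℤ + (+ 1 + + r) * y + (+ r + + (r C 2)) * (y * y)
      ≡⟨ cong (λ c → 1ℤ + + suc r * y + c * (y * y)) pascal ⟩
    1ℤ + + suc r * y + + (suc r C 2) * (y * y)
      ∎
    where
    open ≡mod-Reasoning (y * y * y)
    expand : ∀ y R T → (1ℤ + y) * (1ℤ + R * y + T * (y * y))
                     ≡ 1ℤ + (+ 1 + R) * y + (R + T) * (y * y) + T * (y * y * y)
    expand = solve-∀
    pascal : + r + + (r C 2) ≡ + (suc r C 2)
    pascal = trans (sym (ℤₚ.pos-+ r (r C 2)))
                   (cong +_ (trans (cong (ℕ._+ (r C 2)) (sym (nC1≡n r))) (nCk+nC[k+1]≡[n+1]C[k+1] r 1)))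

  binomial-1-≡mod : ∀ y r → (1ℤ + y) ^ r ≡ 1ℤ + + r * y [mod y * y ]
  binomial-1-≡mod y r = ≡mod-trans (≡mod-weaken (ℤ∣.∣m⇒∣m*n y ℤ∣.∣-refl) (cubic-binomial-≡mod y r))
                                   (+-multiple-≡mod (1ℤ + + r * y) (+ (r C 2)))

  Unit : ℕ → ℤ → Set
  Unit p x = ¬ (+ p ∣ x)

  unit-resp-≡mod : ∀ {p a b} → a ≡ b [mod + p ] → Unit p a → Unit p b
  unit-resp-≡mod {p} {a} {b} a≡b p∤a p∣b =
    p∤a (subst (+ p ∣_) (shift a b) (ℤ∣.∣m∣n⇒∣m+n (≡mod⇒∣ a≡b) p∣b))
    where
    shift : ∀ a b → (a - b) + b ≡ a
    shift = solve-∀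

  unit-<p : ∀ {p m} → 0 < m → m < p → Unit p (+ m)
  unit-<p 0<m m<p p∣m = ℕₚ.<⇒≱ m<p (ℕ∣.∣⇒≤ ⦃ ℕ.>-nonZero 0<m ⦄ (ℤ∣.∣⇒∣ᵤ p∣m))

  module _ {p : ℕ} (p-prime : Prime p) where

    prime-∣-* : ∀ a b → + p ∣ a * b → + p ∣ a ⊎ + p ∣ b
    prime-∣-* a b p∣ab with euclidsLemma ℤ.∣ a ∣ ℤ.∣ b ∣ p-prime
                              (subst (p ℕ∣.∣_) (ℤₚ.abs-* a b) (ℤ∣.∣⇒∣ᵤ p∣ab))
    ... | inj₁ p∣a = inj₁ (ℤ∣.∣ᵤ⇒∣ p∣a)
    ... | inj₂ p∣b = inj₂ (ℤ∣.∣ᵤ⇒∣ p∣b)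

    unit-* : ∀ {a b} → Unit p a → Unit p b → Unit p (a * b)
    unit-* {a} {b} p∤a p∤b p∣ab with prime-∣-* a b p∣ab
    ... | inj₁ p∣a = p∤a p∣a
    ... | inj₂ p∣b = p∤b p∣b

    unit-1 : Unit p 1ℤ
    unit-1 p∣1 = nonTrivial⇒≢1 ⦃ prime⇒nonTrivial p-prime ⦄ (ℕ∣.∣1⇒≡1 (ℤ∣.∣⇒∣ᵤ p∣1))

    unit-^ : ∀ {a} n → Unit p a → Unit p (a ^ n)
    unit-^ zero    _   = unit-1
    unit-^ (suc n) p∤a = unit-* p∤a (unit-^ n p∤a)

    unit⇒coprime-^ : ∀ {u} → Unit p u → ∀ k → Coprime (p ℕ.^ k) ℤ.∣ u ∣
    unit⇒coprime-^ p∤u k = Coprimality.sym (coprime-^ʳ (∤⇒coprime p-prime (p∤u ∘ ℤ∣.∣ᵤ⇒∣)) k)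

    *-cancelˡ-unit-mod-^ : ∀ {u a b} k → Unit p u →
                           u * a ≡ u * b [mod + (p ℕ.^ k) ] → a ≡ b [mod + (p ℕ.^ k) ]
    *-cancelˡ-unit-mod-^ {u} k p∤u = *-cancelˡ-mod {u = u} (unit⇒coprime-^ p∤u k)

    *-cancelˡ-unit-mod : ∀ {u a b} → Unit p u → u * a ≡ u * b [mod + p ] → a ≡ b [mod + p ]
    *-cancelˡ-unit-mod {u} p∤u = *-cancelˡ-mod {u = u}
      (subst (λ n → Coprime n ℤ.∣ u ∣) (ℕₚ.*-identityʳ p) (unit⇒coprime-^ p∤u 1))

  -- Monic polynomials and Lagrange's bound

  -- c₀ ∷ … ∷ c₍d₋₁₎ ∷ [] encodes the monic polynomial c₀ + c₁ x + … + c₍d₋₁₎ x ^ (d - 1) + x ^ d.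
  eval : ∀ {d} → Vec ℤ d → ℤ → ℤ
  eval []       x = 1ℤ
  eval (c ∷ cs) x = c + x * eval cs x

  add-scaled : ∀ {d} → Vec ℤ (suc d) → ℤ → Vec ℤ d → Vec ℤ (suc d)
  add-scaled (c ∷ [])         r []       = c + r ∷ []
  add-scaled (c ∷ cs@(_ ∷ _)) r (e ∷ es) = c + r * e ∷ add-scaled cs r es

  eval-add-scaled : ∀ {d} (f : Vec ℤ (suc d)) r g x →
                    eval (add-scaled f r g) x ≡ eval f x + r * eval g x
  eval-add-scaled (c ∷ []) r [] x = distribute c r x
    where
    distribute : ∀ c r x → (c + r) + x * 1ℤ ≡ (c + x * 1ℤ) + r * 1ℤ
    distribute = solve-∀
  eval-add-scaled (c ∷ cs@(_ ∷ _)) r (e ∷ es) x = begin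
    (c + r * e) + x * eval (add-scaled cs r es) x   ≡⟨ cong (λ v → (c + r * e) + x * v) (eval-add-scaled cs r es x) ⟩
    (c + r * e) + x * (eval cs x + r * eval es x)   ≡⟨ distribute c e x (eval cs x) r (eval es x) ⟩
    (c + x * eval cs x) + r * (e + x * eval es x)   ∎
    where
    open ≡-Reasoning
    distribute : ∀ c e x F r G → (c + r * e) + x * (F + r * G) ≡ (c + x * F) + r * (e + x * G)
    distribute = solve-∀

  divide : ∀ {d} → ℤ → Vec ℤ (suc d) → Vec ℤ d
  divide r (c ∷ [])         = []
  divide r (c ∷ cs@(_ ∷ _)) = add-scaled cs r (divide r cs)

  eval-divide : ∀ {d} r (f : Vec ℤ (suc d)) x → eval f x - eval f r ≡ (x - r) * eval (divide r f) x
  eval-divide r (c ∷ []) x = factor r c x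
    where
    factor : ∀ r c x → (c + x * 1ℤ) - (c + r * 1ℤ) ≡ (x - r) * 1ℤ
    factor = solve-∀
  eval-divide r (c ∷ cs@(_ ∷ _)) x = begin
    (c + x * G) - (c + r * Gᵣ)                         ≡⟨ regroup c x r G Gᵣ ⟩
    (x - r) * G + r * (G - Gᵣ)                         ≡⟨ cong (λ v → (x - r) * G + r * v) (eval-divide r cs x) ⟩
    (x - r) * G + r * ((x - r) * Q)                    ≡⟨ factor x r G Q ⟩
    (x - r) * (G + r * Q)                              ≡⟨ cong ((x - r) *_) (eval-add-scaled cs r (divide r cs) x) ⟨
    (x - r) * eval (add-scaled cs r (divide r cs)) x   ∎
    where
    open ≡-Reasoning
    G = eval cs x
    Gᵣ = eval cs r
    Q = eval (divide r cs) x
    regroup : ∀ c x r G Gᵣ → (c + x * G) - (c + r * Gᵣ) ≡ (x - r) * G + r * (G - Gᵣ)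
    regroup = solve-∀
    factor : ∀ x r G Q → (x - r) * G + r * ((x - r) * Q) ≡ (x - r) * (G + r * Q)
    factor = solve-∀

  x^suc-1 : ∀ d → Vec ℤ (suc d)
  x^suc-1 d = -1ℤ ∷ Vec.replicate d 0ℤ

  eval-x^suc-1 : ∀ d x → eval (x^suc-1 d) x ≡ x ^ suc d - 1ℤ
  eval-x^suc-1 d x = trans (cong (λ v → -1ℤ + x * v) (eval-zeros d)) (ℤₚ.+-comm -1ℤ (x ^ suc d))
    where
    eval-zeros : ∀ d → eval (Vec.replicate d 0ℤ) x ≡ x ^ d
    eval-zeros zero    = refl
    eval-zeros (suc d) =
      trans (ℤₚ.+-identityˡ (x * eval (Vec.replicate d 0ℤ) x)) (cong (x *_) (eval-zeros d))

  module _ {p : ℕ} (p-prime : Prime p) where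

    roots-≤-degree : ∀ {d} (f : Vec ℤ d) (rs : List ℤ) →
                     AllPairs (λ r s → ¬ r ≡ s [mod + p ]) rs →
                     All (λ r → eval f r ≡ 0ℤ [mod + p ]) rs → length rs ≤ d
    roots-≤-degree f         []       _            _             = z≤n
    roots-≤-degree []        (r ∷ rs) _            (1≡0 ∷ _)     =
      contradiction (≡0-mod⇒∣ 1≡0) (unit-1 p-prime)
    roots-≤-degree f@(_ ∷ _) (r ∷ rs) (r≢rs ∷ rs≢) (fr≡0 ∷ frs≡0) =
      s≤s (roots-≤-degree (divide r f) rs rs≢ (All.zipWith root-of-quotient (r≢rs , frs≡0)))
      where
      root-of-quotient : ∀ {s} → ¬ r ≡ s [mod + p ] × eval f s ≡ 0ℤ [mod + p ] →
                         eval (divide r f) s ≡ 0ℤ [mod + p ]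
      root-of-quotient {s} (r≢s , fs≡0) with prime-∣-* p-prime (s - r) (eval (divide r f) s)
        (subst (+ p ∣_) (eval-divide r f s) (ℤ∣.∣m∣n⇒∣m-n (≡0-mod⇒∣ fs≡0) (≡0-mod⇒∣ fr≡0)))
      ... | inj₁ p∣s-r = contradiction (≡mod-sym (∣⇒≡mod p∣s-r)) r≢s
      ... | inj₂ p∣q   = ∣⇒≡0-mod p∣q

  -- Multiplicative orders and primitive roots modulo p

  module _ {p : ℕ} (p-prime : Prime p) where

    private instance
      p≢0 : NonZero p
      p≢0 = prime⇒nonZero p-prime

    record HasOrder (y : ℤ) (d : ℕ) : Set where
      field
        order>0 : 0 < d
        pow≡1   : y ^ d ≡ 1ℤ [mod + p ]
        order-∣ : ∀ {t} → y ^ t ≡ 1ℤ [mod + p ] → d ℕ∣.∣ t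

      ∣⇒pow≡1 : ∀ {t} → d ℕ∣.∣ t → y ^ t ≡ 1ℤ [mod + p ]
      ∣⇒pow≡1 (ℕ∣.divides q refl) =
        subst (λ t → y ^ t ≡ 1ℤ [mod + p ]) (ℕₚ.*-comm d q) (^-*-≡1-mod d q pow≡1)

    open HasOrder public

    unit-%ℕ>0 : ∀ {a} → Unit p a → 0 < a %ℕ p
    unit-%ℕ>0 {a} p∤a = ℕₚ.n≢0⇒n>0 λ r≡0 →
      p∤a (≡0-mod⇒∣ (subst (λ r → a ≡ + r [mod + p ]) r≡0 (≡mod-%ℕ a p)))

    nonzero-residue : ∀ {a} → Unit p a → Fin (p ∸ 1)
    nonzero-residue {a} p∤a = fromℕ< (ℕₚ.∸-monoˡ-< (ℤDivMod.n%ℕd<d a p) (unit-%ℕ>0 p∤a))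

    nonzero-residue-injective : ∀ {a b} (p∤a : Unit p a) (p∤b : Unit p b) →
                                nonzero-residue p∤a ≡ nonzero-residue p∤b → a ≡ b [mod + p ]
    nonzero-residue-injective {a} {b} p∤a p∤b same = begin
      a             ≈⟨ ≡mod-%ℕ a p ⟩
      + (a %ℕ p)    ≡⟨ cong +_ (ℕₚ.∸-cancelʳ-≡ (unit-%ℕ>0 p∤a) (unit-%ℕ>0 p∤b)
                         (trans (sym (Finₚ.toℕ-fromℕ< _)) (trans (cong toℕ same) (Finₚ.toℕ-fromℕ< _)))) ⟩
      + (b %ℕ p)    ≈⟨ ≡mod-%ℕ b p ⟨
      b             ∎
      where open ≡mod-Reasoning (+ p)

    ^-cancel-mod : ∀ {y i j} → Unit p y → i ≤ j → y ^ i ≡ y ^ j [mod + p ] → y ^ (j ∸ i) ≡ 1ℤ [mod + p ]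
    ^-cancel-mod {y} {i} {j} p∤y i≤j yⁱ≡yʲ =
      ≡mod-sym (*-cancelˡ-unit-mod p-prime (unit-^ p-prime i p∤y) (begin
        y ^ i * 1ℤ            ≡⟨ ℤₚ.*-identityʳ (y ^ i) ⟩
        y ^ i                 ≈⟨ yⁱ≡yʲ ⟩
        y ^ j                 ≡⟨ cong (y ^_) (ℕₚ.m+[n∸m]≡n i≤j) ⟨
        y ^ (i ℕ.+ (j ∸ i))   ≡⟨ ℤₚ.^-distribˡ-+-* y i (j ∸ i) ⟩
        y ^ i * y ^ (j ∸ i)   ∎))
      where open ≡mod-Reasoning (+ p)

    -- pigeonhole on the p ∸ 1 nonzero residues of y ^ 0, …, y ^ (p ∸ 1)
    unit-^-period : ∀ {y} → Unit p y → ∃[ D ] 0 < D × D < p × y ^ D ≡ 1ℤ [mod + p ]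
    unit-^-period {y} p∤y =
      let i , j , i<j , same = Finₚ.pigeonhole (ℕₚ.∸-monoʳ-< ℕ.z<s (ℕ.>-nonZero⁻¹ p))
                                                (λ i → nonzero-residue (unit-^ p-prime (toℕ i) p∤y))
      in toℕ j ∸ toℕ i , ℕₚ.m<n⇒0<n∸m i<j ,
         ℕₚ.≤-<-trans (ℕₚ.m∸n≤m (toℕ j) (toℕ i)) (Finₚ.toℕ<n j) ,
         ^-cancel-mod p∤y (ℕₚ.<⇒≤ i<j)
           (nonzero-residue-injective (unit-^ p-prime (toℕ i) p∤y) (unit-^ p-prime (toℕ j) p∤y) same)

    order-exists : ∀ {y} → Unit p y → ∃[ d ] HasOrder y d × d < p
    order-exists {y} p∤y =
      let D , D>0 , D<p , yᴰ≡1 = unit-^-period p∤y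
          d , (d>0 , yᵈ≡1) , minimal = least-witness Q? (D>0 , yᴰ≡1)
          ord : HasOrder y d
          ord = record { order>0 = d>0 ; pow≡1 = yᵈ≡1 ; order-∣ = order-∣′ d>0 yᵈ≡1 minimal }
      in d , ord , ℕₚ.≤-<-trans (ℕ∣.∣⇒≤ ⦃ ℕ.>-nonZero D>0 ⦄ (order-∣ ord yᴰ≡1)) D<p
      where
      Q : ℕ → Set
      Q t = 0 < t × y ^ t ≡ 1ℤ [mod + p ]
      Q? : U.Decidable Q
      Q? t = (0 ℕ.<? t) ×-dec (y ^ t ≡mod? 1ℤ [ + p ])
      order-∣′ : ∀ {d} → 0 < d → y ^ d ≡ 1ℤ [mod + p ] → (∀ {k} → k < d → ¬ Q k) →
                 ∀ {t} → y ^ t ≡ 1ℤ [mod + p ] → d ℕ∣.∣ t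
      order-∣′ {d} d>0 yᵈ≡1 minimal {t} yᵗ≡1 = ℕ∣.m%n≡0⇒n∣m t d (ℕₚ.n≤0⇒n≡0 (ℕₚ.≮⇒≥ λ r>0 →
        minimal (ℕDivMod.m%n<n t d) (r>0 , ≡mod-trans (≡mod-sym (^-%-≡mod d t yᵈ≡1)) yᵗ≡1)))
        where instance _ = ℕ.>-nonZero d>0

    HasOrder-resp-≡mod : ∀ {y z d} → y ≡ z [mod + p ] → HasOrder y d → HasOrder z d
    HasOrder-resp-≡mod {d = d} y≡z ord = record
      { order>0 = order>0 ord
      ; pow≡1   = ≡mod-trans (^-cong-mod d (≡mod-sym y≡z)) (pow≡1 ord)
      ; order-∣ = λ {t} zᵗ≡1 → order-∣ ord (≡mod-trans (^-cong-mod t y≡z) zᵗ≡1)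
      }

    HasOrder-unique : ∀ {y d e} → HasOrder y d → HasOrder y e → d ≡ e
    HasOrder-unique ord ord′ = ℕ∣.∣-antisym (order-∣ ord (pow≡1 ord′)) (order-∣ ord′ (pow≡1 ord))

    HasOrder-^ : ∀ {y} e {m} → HasOrder y (e ℕ.* m) → HasOrder (y ^ e) m
    HasOrder-^ {y} e {m} ord = record
      { order>0 = ℕ.>-nonZero⁻¹ m ⦃ ℕₚ.m*n≢0⇒n≢0 e ⦄
      ; pow≡1   = subst (_≡ 1ℤ [mod + p ]) (sym (ℤₚ.^-*-assoc y e m)) (pow≡1 ord)
      ; order-∣ = λ {t} yᵉᵗ≡1 → ℕ∣.*-cancelˡ-∣ e ⦃ ℕₚ.m*n≢0⇒m≢0 e ⦄
                    (order-∣ ord (subst (_≡ 1ℤ [mod + p ]) (ℤₚ.^-*-assoc y e t) yᵉᵗ≡1))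
      }
      where instance _ = ℕ.>-nonZero (order>0 ord)

    HasOrder-* : ∀ {a b m n} → HasOrder a m → HasOrder b n → Coprime m n → HasOrder (a * b) (m ℕ.* n)
    HasOrder-* {a} {b} {m} {n} ordᵃ ordᵇ m⊥n = record
      { order>0 = ℕₚ.*-mono-< (order>0 ordᵃ) (order>0 ordᵇ)
      ; pow≡1   = begin
          (a * b) ^ (m ℕ.* n)             ≡⟨ ^-distribʳ-* a b (m ℕ.* n) ⟩
          a ^ (m ℕ.* n) * b ^ (m ℕ.* n)   ≈⟨ *-cong-mod (∣⇒pow≡1 ordᵃ (ℕ∣.m∣m*n n)) (∣⇒pow≡1 ordᵇ (ℕ∣.n∣m*n m)) ⟩
          1ℤ * 1ℤ                         ∎
      ; order-∣ = λ abᵗ≡1 → coprime-*-∣ m⊥n (m∣t abᵗ≡1) (n∣t abᵗ≡1)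
      }
      where
      open ≡mod-Reasoning (+ p)
      cofactor-pow≡1 : ∀ x {y d t} → HasOrder y d → (x * y) ^ t ≡ 1ℤ [mod + p ] → x ^ (t ℕ.* d) ≡ 1ℤ [mod + p ]
      cofactor-pow≡1 x {y} {d} {t} ordʸ xyᵗ≡1 = begin
        x ^ (t ℕ.* d)                     ≡⟨ ℤₚ.*-identityʳ (x ^ (t ℕ.* d)) ⟨
        x ^ (t ℕ.* d) * 1ℤ                ≈⟨ *-congˡ-mod (x ^ (t ℕ.* d)) (∣⇒pow≡1 ordʸ (ℕ∣.n∣m*n t)) ⟨
        x ^ (t ℕ.* d) * y ^ (t ℕ.* d)     ≡⟨ ^-distribʳ-* x y (t ℕ.* d) ⟨
        (x * y) ^ (t ℕ.* d)               ≈⟨ ^-*-≡1-mod t d xyᵗ≡1 ⟩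
        1ℤ                                ∎
      m∣t : ∀ {t} → (a * b) ^ t ≡ 1ℤ [mod + p ] → m ℕ∣.∣ t
      m∣t {t} abᵗ≡1 = coprime-divisor m⊥n
        (subst (m ℕ∣.∣_) (ℕₚ.*-comm t n) (order-∣ ordᵃ (cofactor-pow≡1 a {t = t} ordᵇ abᵗ≡1)))
      n∣t : ∀ {t} → (a * b) ^ t ≡ 1ℤ [mod + p ] → n ℕ∣.∣ t
      n∣t {t} abᵗ≡1 = coprime-divisor (Coprimality.sym m⊥n)
        (subst (n ℕ∣.∣_) (ℕₚ.*-comm t m) (order-∣ ordᵇ (cofactor-pow≡1 b {t = t} ordᵃ
          (subst (λ z → z ^ t ≡ 1ℤ [mod + p ]) (ℤₚ.*-comm a b) abᵗ≡1))))

    larger-order : ∀ {c x M n} → Unit p c → Unit p x → HasOrder c M → HasOrder x n → ¬ n ℕ∣.∣ M →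
                   ∃[ z ] ∃[ N ] Unit p z × HasOrder z N × M < N
    larger-order {c} {x} {M} {n} p∤c p∤x ordᶜ ordˣ n∤M with prime-power-∤ (order>0 ordˣ) n∤M
    ... | q , e , q-prime , qᵉ∣n , qᵉ∤M with capped-valuation q M e
    ... | s , s≤e , ℕ∣.divides M′ M≡M′qˢ , maximal with ℕₚ.m≤n⇒m<n∨m≡n s≤e
    ...   | inj₂ refl = contradiction (ℕ∣.divides M′ M≡M′qˢ) qᵉ∤M
    ...   | inj₁ s<e with qᵉ∣n
    ...     | ℕ∣.divides n′ n≡n′qᵉ =
      c ^ (q ℕ.^ s) * x ^ n′ , M′ ℕ.* q ℕ.^ e ,
      unit-* p-prime (unit-^ p-prime (q ℕ.^ s) p∤c) (unit-^ p-prime n′ p∤x) ,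
      HasOrder-* (HasOrder-^ (q ℕ.^ s) (subst (HasOrder c) (trans M≡M′qˢ (ℕₚ.*-comm M′ (q ℕ.^ s))) ordᶜ))
                 (HasOrder-^ n′ (subst (HasOrder x) n≡n′qᵉ ordˣ))
                 (coprime-^ʳ (∤⇒coprime q-prime q∤M′) e) ,
      subst (_< M′ ℕ.* q ℕ.^ e) (sym M≡M′qˢ)
        (ℕₚ.*-monoʳ-< M′ ⦃ M′≢0 ⦄ (ℕₚ.^-monoʳ-< q (prime>1 q-prime) s<e))
      where
      q∤M′ : ¬ q ℕ∣.∣ M′
      q∤M′ q∣M′ = maximal s<e
        (subst (q ℕ.^ suc s ℕ∣.∣_) (sym M≡M′qˢ) (ℕ∣.*-pres-∣ q∣M′ (ℕ∣.∣-refl {q ℕ.^ s})))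
      M′≢0 : NonZero M′
      M′≢0 = ℕₚ.m*n≢0⇒m≢0 M′ ⦃ subst NonZero M≡M′qˢ (ℕ.>-nonZero (order>0 ordᶜ)) ⦄

    unit? : ∀ y → Dec (Unit p y)
    unit? y = Dec.¬? (+ p ℤ∣.∣? y)

    -- with junk value 0 when p ∣ y
    order : ℤ → ℕ
    order y with unit? y
    ... | yes p∤y = proj₁ (order-exists p∤y)
    ... | no  _   = 0

    order-spec : ∀ {y} → Unit p y → HasOrder y (order y)
    order-spec {y} p∤y with unit? y
    ... | yes p∤y′ = proj₁ (proj₂ (order-exists p∤y′))
    ... | no  p∣y  = contradiction p∤y p∣y

    order<p : ∀ y → order y < p
    order<p y with unit? y
    ... | yes p∤y = proj₂ (proj₂ (order-exists p∤y))
    ... | no  _   = ℕ.>-nonZero⁻¹ p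

    order-nonunit : ∀ {y} → ¬ Unit p y → order y ≡ 0
    order-nonunit {y} p∣y with unit? y
    ... | yes p∤y = contradiction p∤y p∣y
    ... | no  _   = refl

    order-resp-≡mod : ∀ {y z} → y ≡ z [mod + p ] → Unit p y → order y ≡ order z
    order-resp-≡mod y≡z p∤y =
      HasOrder-unique (HasOrder-resp-≡mod y≡z (order-spec p∤y)) (order-spec (unit-resp-≡mod y≡z p∤y))

    -- maximal among the residues 0, …, p ∸ 1, hence among all units
    max-order-unit : ∃[ c ] Unit p (+ c) × (∀ {y} → Unit p y → order y ≤ order (+ c))
    max-order-unit = c , c-unit , maximal
      where
      c = argmax (order ∘ +_) 1 (upTo p)
      maximal : ∀ {y} → Unit p y → order y ≤ order (+ c)
      maximal {y} p∤y = subst (_≤ order (+ c)) (sym (order-resp-≡mod (≡mod-%ℕ y p) p∤y))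
        (All.lookup (f[xs]≤f[argmax] {f = order ∘ +_} 1 (upTo p)) (∈-upTo⁺ (ℤDivMod.n%ℕd<d y p)))
      c-unit : Unit p (+ c)
      c-unit p∣c = contradiction (order-nonunit (λ p∤c → p∤c p∣c)) (ℕₚ.>⇒≢ (ℕₚ.<-≤-trans
        (order>0 (order-spec (unit-1 p-prime))) (f[⊥]≤f[argmax] {f = order ∘ +_} 1 (upTo p))))

    -- Otherwise larger-order would produce an order above the maximal one.
    pow-max-order≡1 : ∀ {c} → Unit p c → (∀ {y} → Unit p y → order y ≤ order c) →
                      ∀ {y} → Unit p y → y ^ order c ≡ 1ℤ [mod + p ]
    pow-max-order≡1 {c} p∤c maximal {y} p∤y with order y ℕ∣.∣? order c
    ... | yes ∣ = ∣⇒pow≡1 (order-spec p∤y) ∣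
    ... | no  ∤ with larger-order p∤c p∤y (order-spec p∤c) (order-spec p∤y) ∤
    ...   | z , N , p∤z , ordᶻ , order-c<N = contradiction
      (subst (_≤ order c) (HasOrder-unique (order-spec p∤z) ordᶻ) (maximal p∤z)) (ℕₚ.<⇒≱ order-c<N)

    -- c ^ 0 * u, …, c ^ (M ∸ 1) * u and any w outside them would be M + 1 roots of x ^ M - 1.
    units-transitive : ∀ {c M} → Unit p c → HasOrder c M → (∀ {y} → Unit p y → y ^ M ≡ 1ℤ [mod + p ]) →
                       ∀ {u w} → Unit p u → Unit p w → ∃[ m ] c ^ m * u ≡ w [mod + p ]
    units-transitive {M = zero} _ ordᶜ = contradiction (order>0 ordᶜ) λ ()
    units-transitive {c} {suc M} p∤c ordᶜ all-roots {u} {w} p∤u p∤w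
      with ℕₚ.anyUpTo? (λ m → c ^ m * u ≡mod? w [ + p ]) (suc M)
    ... | yes (m , _ , cᵐu≡w) = m , cᵐu≡w
    ... | no  none            = contradiction (roots-≤-degree p-prime (x^suc-1 M) rs distinct roots) too-many
      where
      cⁱu : ℕ → ℤ
      cⁱu i = c ^ i * u
      rs = w ∷ applyUpTo cⁱu (suc M)
      too-many : ¬ length rs ≤ suc M
      too-many = ℕₚ.n≮n (suc M) ∘ subst (_≤ suc M) (cong suc (length-applyUpTo cⁱu (suc M)))
      root : ∀ {r} → Unit p r → eval (x^suc-1 M) r ≡ 0ℤ [mod + p ]
      root {r} p∤r = subst₂ (_≡_[mod + p ]) (sym (eval-x^suc-1 M r)) (ℤₚ.+-inverseʳ 1ℤ)
                            (+-cong-mod (all-roots p∤r) ≡mod-refl)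
      roots : All (λ r → eval (x^suc-1 M) r ≡ 0ℤ [mod + p ]) rs
      roots = root p∤w ∷ Allₚ.applyUpTo⁺₂ cⁱu (suc M) (λ i → root (unit-* p-prime (unit-^ p-prime i p∤c) p∤u))
      powers-distinct : ∀ {i j} → i < j → j < suc M → ¬ c ^ i * u ≡ c ^ j * u [mod + p ]
      powers-distinct {i} {j} i<j j≤M cⁱu≡cʲu = ℕₚ.<⇒≱ (ℕₚ.≤-<-trans (ℕₚ.m∸n≤m j i) j≤M)
        (ℕ∣.∣⇒≤ ⦃ ℕ.>-nonZero (ℕₚ.m<n⇒0<n∸m i<j) ⦄ (order-∣ ordᶜ (^-cancel-mod p∤c (ℕₚ.<⇒≤ i<j)
          (*-cancelˡ-unit-mod p-prime p∤u
            (subst₂ (_≡_[mod + p ]) (ℤₚ.*-comm (c ^ i) u) (ℤₚ.*-comm (c ^ j) u) cⁱu≡cʲu)))))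
      distinct : AllPairs (λ r s → ¬ r ≡ s [mod + p ]) rs
      distinct = Allₚ.applyUpTo⁺₁ cⁱu (suc M) (λ i<M w≡cⁱu → none (_ , i<M , ≡mod-sym w≡cⁱu))
               ∷ AllPairsₚ.applyUpTo⁺₁ cⁱu (suc M) powers-distinct

  -- a is a primitive root modulo n (a power of p), phrased as: its powers act transitively on units
  IsPrimitiveRoot : ℕ → ℤ → ℤ → Set
  IsPrimitiveRoot p n a = ∀ {u w} → Unit p u → Unit p w → ∃[ m ] a ^ m * u ≡ w [mod n ]

  IsPrimitiveRoot-resp-≡mod : ∀ {p n a b} → a ≡ b [mod n ] → IsPrimitiveRoot p n a → IsPrimitiveRoot p n b
  IsPrimitiveRoot-resp-≡mod {b = b} a≡b prim {u} p∤u p∤w =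
    let m , aᵐu≡w = prim p∤u p∤w
    in m , ≡mod-trans (*-congʳ-mod u (^-cong-mod m (≡mod-sym a≡b))) aᵐu≡w

  primitive-root-mod-prime : ∀ {p} → Prime p → ∃[ c ] Unit p (+ c) × IsPrimitiveRoot p (+ p) (+ c)
  primitive-root-mod-prime p-prime =
    let c , p∤c , maximal = max-order-unit p-prime
    in c , p∤c , units-transitive p-prime p∤c (order-spec p-prime p∤c)
                                  (pow-max-order≡1 p-prime p∤c maximal)

  -- Lifting primitive roots to p ^ k

  module _ {p : ℕ} (p-prime : Prime p) where

    private instance
      p≢0 : NonZero p
      p≢0 = prime⇒nonZero p-prime

    pC2≡p*[p/2] : p ≢ 2 → + (p C 2) ≡ + p * + (p ℕ./ 2)
    pC2≡p*[p/2] p≢2 = trans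
      (cong +_ (subst (λ n → (n C 2) ≡ n ℕ.* (p ℕ./ 2)) (sym (odd-prime⇒p≡1+[p/2]*2 p-prime p≢2))
                      ([1+q*2]C2≡[1+q*2]*q (p ℕ./ 2))))
      (ℤₚ.pos-* p (p ℕ./ 2))

    -- Expand modulo B³; for j = 0 the term (p C 2) B² vanishes modulo p ^ 3 only because p ∣ p C 2.
    pow-p-lift : p ≢ 2 → ∀ j {T} → Unit p T →
                 ∃[ T′ ] Unit p T′ × (1ℤ + + (p ℕ.^ suc j) * T) ^ p ≡ 1ℤ + + (p ℕ.^ suc (suc j)) * T′
    pow-p-lift p≢2 j {T} p∤T = T + S * P , unit-resp-≡mod (≡mod-sym (+-multiple-≡mod T S)) p∤T , (begin
      (1ℤ + B) ^ p
        ≡⟨ quotient-form cubic ⟩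
      1ℤ + P * B + + (p C 2) * (B * B) + E * (B * B * B)
        ≡⟨ cong₂ (λ c b → 1ℤ + P * b + c * (b * b) + E * (b * b * b))
                 (pC2≡p*[p/2] p≢2) (cong (_* T) (ℤₚ.pos-* p (p ℕ.^ j))) ⟩
      1ℤ + P * (P * W * T) + P * Q * (P * W * T * (P * W * T)) + E * (P * W * T * (P * W * T) * (P * W * T))
        ≡⟨ collect P W T Q E ⟩
      1ℤ + P * (P * W) * (T + S * P)
        ≡⟨ cong (λ n → 1ℤ + n * (T + S * P)) (trans (ℤₚ.pos-* p (p ℕ.^ suc j)) (cong (P *_) (ℤₚ.pos-* p (p ℕ.^ j)))) ⟨
      1ℤ + + (p ℕ.^ suc (suc j)) * (T + S * P)
        ∎)
      where
      open ≡-Reasoning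
      P = + p
      W = + (p ℕ.^ j)
      Q = + (p ℕ./ 2)
      B = + (p ℕ.^ suc j) * T
      cubic = cubic-binomial-≡mod B p
      E = quotient cubic
      S = Q * W * T * T + W * W * T * T * T * E
      collect : ∀ P W T Q E →
                1ℤ + P * (P * W * T) + P * Q * (P * W * T * (P * W * T)) + E * (P * W * T * (P * W * T) * (P * W * T))
                ≡ 1ℤ + P * (P * W) * (T + (Q * W * T * T + W * W * T * T * T * E) * P)
      collect = solve-∀

    pow-pʲ-lift : p ≢ 2 → ∀ {h} → h ≡ 1ℤ [mod + p ] → ¬ h ≡ 1ℤ [mod + p * + p ] →
                 ∀ j → ∃[ T ] Unit p T × h ^ (p ℕ.^ j) ≡ 1ℤ + + (p ℕ.^ suc j) * T
    pow-pʲ-lift p≢2 {h} h≡1@(mod-intro T₀ h-1≡T₀p) h≢1 zero = T₀ , p∤T₀ , (begin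
      h ^ 1                   ≡⟨ ℤₚ.^-identityʳ h ⟩
      h                       ≡⟨ quotient-form h≡1 ⟩
      1ℤ + T₀ * + p           ≡⟨ cong (λ n → 1ℤ + n) (ℤₚ.*-comm T₀ (+ p)) ⟩
      1ℤ + + p * T₀           ≡⟨ cong (λ n → 1ℤ + + n * T₀) (ℕₚ.*-identityʳ p) ⟨
      1ℤ + + (p ℕ.* 1) * T₀   ∎)
      where
      open ≡-Reasoning
      p∤T₀ : Unit p T₀
      p∤T₀ (divides t T₀≡tp) =
        h≢1 (mod-intro t (trans h-1≡T₀p (trans (cong (_* + p) T₀≡tp) (ℤₚ.*-assoc t (+ p) (+ p)))))
    pow-pʲ-lift p≢2 {h} h≡1 h≢1 (suc j) =
      let T , p∤T , hᵖʲ≡ = pow-pʲ-lift p≢2 h≡1 h≢1 j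
          T′ , p∤T′ , lifted = pow-p-lift p≢2 j p∤T
      in T′ , p∤T′ , (begin
        h ^ (p ℕ.* p ℕ.^ j)               ≡⟨ cong (h ^_) (ℕₚ.*-comm p (p ℕ.^ j)) ⟩
        h ^ (p ℕ.^ j ℕ.* p)               ≡⟨ ℤₚ.^-*-assoc h (p ℕ.^ j) p ⟨
        (h ^ (p ℕ.^ j)) ^ p               ≡⟨ cong (_^ p) hᵖʲ≡ ⟩
        (1ℤ + + (p ℕ.^ suc j) * T) ^ p    ≡⟨ lifted ⟩
        1ℤ + + (p ℕ.^ suc (suc j)) * T′   ∎)
      where open ≡-Reasoning

    pʲ⁺²∣[pʲ⁺¹T]² : ∀ j T → + (p ℕ.^ suc (suc j)) ∣ + (p ℕ.^ suc j) * T * (+ (p ℕ.^ suc j) * T)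
    pʲ⁺²∣[pʲ⁺¹T]² j T = divides (W * T * T) (begin
      + (p ℕ.^ suc j) * T * (+ (p ℕ.^ suc j) * T)   ≡⟨ cong (λ x → x * T * (x * T)) (ℤₚ.pos-* p (p ℕ.^ j)) ⟩
      P * W * T * (P * W * T)                       ≡⟨ regroup P W T ⟩
      W * T * T * (P * (P * W))                     ≡⟨ cong (λ x → W * T * T * (P * x)) (ℤₚ.pos-* p (p ℕ.^ j)) ⟨
      W * T * T * (P * + (p ℕ.^ suc j))             ≡⟨ cong (W * T * T *_) (ℤₚ.pos-* p (p ℕ.^ suc j)) ⟨
      W * T * T * + (p ℕ.^ suc (suc j))             ∎)
      where
      open ≡-Reasoning
      P = + p
      W = + (p ℕ.^ j)
      regroup : ∀ P W T → P * W * T * (P * W * T) ≡ W * T * T * (P * (P * W))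
      regroup = solve-∀

    digit-correction : ∀ j {v w r T} (v≡w : v ≡ w [mod + (p ℕ.^ suc j) ]) →
                       + r * (T * v) + quotient v≡w ≡ 0ℤ [mod + p ] →
                       (1ℤ + + r * (+ (p ℕ.^ suc j) * T)) * v ≡ w [mod + (p ℕ.^ suc (suc j)) ]
    digit-correction j {v} {w} {r} {T} (mod-intro q v-w≡qpʲ⁺¹) (mod-intro K rTv+q≡Kp) = mod-intro K (begin
      (1ℤ + + r * (Pʲ⁺¹ * T)) * v - w       ≡⟨ expand (+ r) Pʲ⁺¹ T v w ⟩
      (v - w) + Pʲ⁺¹ * (+ r * (T * v))      ≡⟨ cong (λ d → d + Pʲ⁺¹ * (+ r * (T * v))) v-w≡qpʲ⁺¹ ⟩
      q * Pʲ⁺¹ + Pʲ⁺¹ * (+ r * (T * v))     ≡⟨ factor q Pʲ⁺¹ (+ r * (T * v)) ⟩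
      Pʲ⁺¹ * (+ r * (T * v) + q - 0ℤ)       ≡⟨ cong (Pʲ⁺¹ *_) rTv+q≡Kp ⟩
      Pʲ⁺¹ * (K * + p)                      ≡⟨ reorder Pʲ⁺¹ K (+ p) ⟩
      K * (+ p * Pʲ⁺¹)                      ≡⟨ cong (K *_) (ℤₚ.pos-* p (p ℕ.^ suc j)) ⟨
      K * + (p ℕ.^ suc (suc j))             ∎)
      where
      open ≡-Reasoning
      Pʲ⁺¹ = + (p ℕ.^ suc j)
      expand : ∀ R X T v w → (1ℤ + R * (X * T)) * v - w ≡ (v - w) + X * (R * (T * v))
      expand = solve-∀
      factor : ∀ q X y → q * X + X * y ≡ X * (y + q - 0ℤ)
      factor = solve-∀
      reorder : ∀ X K P → X * (K * P) ≡ K * (P * X)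
      reorder = solve-∀

    module _ {h : ℤ} (p∤h : Unit p h)
             (p-adic : ∀ j → ∃[ T ] Unit p T × h ^ (p ℕ.^ j) ≡ 1ℤ + + (p ℕ.^ suc j) * T)
             (inverse : ∀ {z} → Unit p z → ∃[ z′ ] z′ * z ≡ 1ℤ [mod + p ]) where

      next-digit : ∀ q {z} → Unit p z → ∃[ r ] + r * z + q ≡ 0ℤ [mod + p ]
      next-digit q {z} p∤z = let z′ , z′z≡1 = inverse p∤z in (- (q * z′)) %ℕ p , (begin
        + ((- (q * z′)) %ℕ p) * z + q   ≈⟨ +-cong-mod (*-congʳ-mod z (≡mod-%ℕ (- (q * z′)) p)) ≡mod-refl ⟨
        - (q * z′) * z + q              ≡⟨ regroup q z′ z ⟩
        - q * (z′ * z) + q              ≈⟨ +-cong-mod (*-congˡ-mod (- q) z′z≡1) ≡mod-refl ⟩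
        - q * 1ℤ + q                    ≡⟨ cancel q ⟩
        0ℤ                              ∎)
        where
        open ≡mod-Reasoning (+ p)
        regroup : ∀ q z′ z → - (q * z′) * z + q ≡ - q * (z′ * z) + q
        regroup = solve-∀
        cancel : ∀ q → - q * 1ℤ + q ≡ 0ℤ
        cancel = solve-∀

      -- Hensel-style: multiplying by h ^ (p ^ j * r) ≡ 1 + r p ^ (j + 1) T fixes the next p-adic digit.
      lift-step : ∀ j {u w} → Unit p u → ∃[ m ] h ^ m * u ≡ w [mod + (p ℕ.^ suc j) ] →
                  ∃[ m ] h ^ m * u ≡ w [mod + (p ℕ.^ suc (suc j)) ]
      lift-step j {u} {w} p∤u (m , v≡w) = p ℕ.^ j ℕ.* r ℕ.+ m , (begin
        h ^ (p ℕ.^ j ℕ.* r ℕ.+ m) * u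
          ≡⟨ cong (_* u) (ℤₚ.^-distribˡ-+-* h (p ℕ.^ j ℕ.* r) m) ⟩
        h ^ (p ℕ.^ j ℕ.* r) * h ^ m * u
          ≡⟨ ℤₚ.*-assoc (h ^ (p ℕ.^ j ℕ.* r)) (h ^ m) u ⟩
        h ^ (p ℕ.^ j ℕ.* r) * v
          ≡⟨ cong (_* v) (trans (sym (ℤₚ.^-*-assoc h (p ℕ.^ j) r)) (cong (_^ r) hᵖʲ≡1+B)) ⟩
        (1ℤ + B) ^ r * v
          ≈⟨ *-congʳ-mod v (≡mod-weaken (pʲ⁺²∣[pʲ⁺¹T]² j T) (binomial-1-≡mod B r)) ⟩
        (1ℤ + + r * B) * v
          ≈⟨ digit-correction j {r = r} {T} v≡w rTv+q≡0 ⟩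
        w ∎)
        where
        open ≡mod-Reasoning (+ (p ℕ.^ suc (suc j)))
        v = h ^ m * u
        T = proj₁ (p-adic j)
        p∤T = proj₁ (proj₂ (p-adic j))
        hᵖʲ≡1+B = proj₂ (proj₂ (p-adic j))
        B = + (p ℕ.^ suc j) * T
        p∤Tv = unit-* p-prime p∤T (unit-* p-prime (unit-^ p-prime m p∤h) p∤u)
        r = proj₁ (next-digit (quotient v≡w) p∤Tv)
        rTv+q≡0 = proj₂ (next-digit (quotient v≡w) p∤Tv)

      lift-congruence : ∀ j {u w} → Unit p u → u ≡ w [mod + p ] →
                        ∃[ m ] h ^ m * u ≡ w [mod + (p ℕ.^ suc j) ]
      lift-congruence zero {u} {w} _ u≡w =
        0 , subst₂ (λ a n → a ≡ w [mod + n ]) (sym (ℤₚ.*-identityˡ u)) (sym (ℕₚ.*-identityʳ p)) u≡w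
      lift-congruence (suc j) p∤u u≡w = lift-step j p∤u (lift-congruence j p∤u u≡w)

    -- c or c + p works: (c + p) ^ M ≡ c ^ M + M c ^ (M - 1) p modulo p², and p ∤ M c ^ (M - 1).
    non-lifting-root : ∀ {c M} → Unit p (+ c) → 0 < M → M < p →
                       ∃[ a ] + a ≡ + c [mod + p ] × ¬ (+ a) ^ M ≡ 1ℤ [mod + p * + p ]
    non-lifting-root {c} {suc M} p∤c 0<M M<p with (+ c) ^ suc M ≡mod? 1ℤ [ + p * + p ]
    ... | no  cᴹ≢1 = c , ≡mod-refl , cᴹ≢1
    ... | yes cᴹ≡1 = c ℕ.+ p , c+p≡c , λ [c+p]ᴹ≡1 → [ (unit-<p 0<M M<p) , (unit-^ p-prime M p∤c) ]′
        (prime-∣-* p-prime (+ suc M) ((+ c) ^ M)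
          (ℤ∣.*-cancelʳ-∣ (+ p) (≡0-mod⇒∣ (derivative≡0 [c+p]ᴹ≡1))))
      where
      c+p≡c : + (c ℕ.+ p) ≡ + c [mod + p ]
      c+p≡c = subst (_≡ + c [mod + p ])
                    (trans (cong (λ x → + c + x) (ℤₚ.*-identityˡ (+ p))) (sym (ℤₚ.pos-+ c p)))
                    (+-multiple-≡mod (+ c) 1ℤ)
      derivative≡0 : (+ (c ℕ.+ p)) ^ suc M ≡ 1ℤ [mod + p * + p ] →
                     + suc M * (+ c) ^ M * + p ≡ 0ℤ [mod + p * + p ]
      derivative≡0 [c+p]ᴹ≡1 = begin
        + suc M * (+ c) ^ M * + p
          ≡⟨ cancel ((+ c) ^ suc M) (+ suc M * (+ c) ^ M * + p) ⟨
        ((+ c) ^ suc M + + suc M * (+ c) ^ M * + p) - (+ c) ^ suc M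
          ≈⟨ +-cong-mod (binomial-≡mod (+ c) (+ p) M) ≡mod-refl ⟨
        (+ c + + p) ^ suc M - (+ c) ^ suc M
          ≡⟨ cong (λ x → x ^ suc M - (+ c) ^ suc M) (ℤₚ.pos-+ c p) ⟨
        (+ (c ℕ.+ p)) ^ suc M - (+ c) ^ suc M
          ≈⟨ +-cong-mod [c+p]ᴹ≡1 (-‿cong-mod cᴹ≡1) ⟩
        1ℤ - 1ℤ
          ≡⟨ ℤₚ.+-inverseʳ 1ℤ ⟩
        0ℤ ∎
        where
        open ≡mod-Reasoning (+ p * + p)
        cancel : ∀ a b → (a + b) - a ≡ b
        cancel = solve-∀

    -- 2 is a unit as p is odd, and it cannot be a power of a ≡ 1.
    primitive-root-minus-1-unit : p ≢ 2 → ∀ {a} → IsPrimitiveRoot p (+ p) a → Unit p (a - 1ℤ)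
    primitive-root-minus-1-unit p≢2 {a} prim p∣a-1 =
      let m , aᵐ≡2 = prim (unit-1 p-prime) (unit-<p (s≤s z≤n) 2<p)
      in unit-1 p-prime (≡mod⇒∣ (begin
        + 2                ≈⟨ aᵐ≡2 ⟨
        a ^ m * 1ℤ         ≈⟨ *-congʳ-mod 1ℤ (^-cong-mod m a≡1) ⟩
        1ℤ ^ m * 1ℤ        ≡⟨ cong (_* 1ℤ) (ℤₚ.^-zeroˡ m) ⟩
        1ℤ                 ∎))
      where
      open ≡mod-Reasoning (+ p)
      2<p : 2 < p
      2<p = ℕₚ.≤∧≢⇒< (prime>1 p-prime) (p≢2 ∘ sym)
      a≡1 : a ≡ 1ℤ [mod + p ]
      a≡1 = ∣⇒≡mod p∣a-1

    lift-primitive-root : p ≢ 2 → ∀ {a M} → Unit p a → IsPrimitiveRoot p (+ p) a →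
                          a ^ M ≡ 1ℤ [mod + p ] → ¬ a ^ M ≡ 1ℤ [mod + p * + p ] →
                          ∀ k → IsPrimitiveRoot p (+ (p ℕ.^ k)) a
    lift-primitive-root p≢2 {a} _ _ _ _ zero {u} {w} _ _ =
      0 , mod-intro (a ^ 0 * u - w) (sym (ℤₚ.*-identityʳ (a ^ 0 * u - w)))
    lift-primitive-root p≢2 {a} {M} p∤a primᵃ aᴹ≡1 aᴹ≢1 (suc j) {u} {w} p∤u p∤w =
      let m₀ , aᵐ⁰u≡w = primᵃ p∤u p∤w
          m₁ , lifted = lift-congruence (unit-^ p-prime M p∤a) (pow-pʲ-lift p≢2 aᴹ≡1 aᴹ≢1) inverse
                                        j (unit-* p-prime (unit-^ p-prime m₀ p∤a) p∤u) aᵐ⁰u≡w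
      in M ℕ.* m₁ ℕ.+ m₀ , subst (_≡ w [mod + (p ℕ.^ suc j) ]) (merge m₀ m₁) lifted
      where
      inverse : ∀ {z} → Unit p z → ∃[ z′ ] z′ * z ≡ 1ℤ [mod + p ]
      inverse p∤z = let m , aᵐz≡1 = primᵃ p∤z (unit-1 p-prime) in a ^ m , aᵐz≡1
      merge : ∀ m₀ m₁ → (a ^ M) ^ m₁ * (a ^ m₀ * u) ≡ a ^ (M ℕ.* m₁ ℕ.+ m₀) * u
      merge m₀ m₁ = begin
        (a ^ M) ^ m₁ * (a ^ m₀ * u)     ≡⟨ ℤₚ.*-assoc ((a ^ M) ^ m₁) (a ^ m₀) u ⟨
        (a ^ M) ^ m₁ * a ^ m₀ * u       ≡⟨ cong (λ x → x * a ^ m₀ * u) (ℤₚ.^-*-assoc a M m₁) ⟩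
        a ^ (M ℕ.* m₁) * a ^ m₀ * u     ≡⟨ cong (_* u) (ℤₚ.^-distribˡ-+-* a (M ℕ.* m₁) m₀) ⟨
        a ^ (M ℕ.* m₁ ℕ.+ m₀) * u       ∎
        where open ≡-Reasoning

    odd-prime-power-primitive-root : p ≢ 2 →
      ∃[ a ] Unit p (+ a) × Unit p (+ a - 1ℤ) × ∀ k → IsPrimitiveRoot p (+ (p ℕ.^ k)) (+ a)
    odd-prime-power-primitive-root p≢2 =
      let c , p∤c , primᶜ = primitive-root-mod-prime p-prime
          ordᶜ = order-spec p-prime p∤c
          a , a≡c , aᴹ≢1 = non-lifting-root p∤c (order>0 ordᶜ) (order<p p-prime (+ c))
          primᵃ = IsPrimitiveRoot-resp-≡mod (≡mod-sym a≡c) primᶜ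
          p∤a = unit-resp-≡mod (≡mod-sym a≡c) p∤c
      in a , p∤a , primitive-root-minus-1-unit p≢2 primᵃ ,
         lift-primitive-root p≢2 {M = order p-prime (+ c)} p∤a primᵃ
           (≡mod-trans (^-cong-mod (order p-prime (+ c)) a≡c) (pow≡1 ordᶜ)) aᴹ≢1

  -- Counting cycles through orbit minima

  iter-+ : ∀ {A : Set} (f : A → A) m n x → iter f (m ℕ.+ n) x ≡ iter f m (iter f n x)
  iter-+ f zero    n x = refl
  iter-+ f (suc m) n x = cong f (iter-+ f m n x)

  iter-periodic : ∀ {A : Set} (f : A → A) {d y} → iter f d y ≡ y → ∀ q → iter f (q ℕ.* d) y ≡ y
  iter-periodic f         fix zero    = refl
  iter-periodic f {d} {y} fix (suc q) =
    trans (iter-+ f d (q ℕ.* d) y) (trans (cong (iter f d) (iter-periodic f fix q)) fix)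

  -- the forward orbit of x is eventually periodic with preperiod + period ≤ n (pigeonhole)
  iter-below : ∀ {n} (f : Fin n → Fin n) x t → ∃[ m ] m < n × iter f t x ≡ iter f m x
  iter-below {n} f x t with Finₚ.pigeonhole (ℕₚ.n<1+n n) (λ i → iter f (toℕ i) x)
  ... | i , j , i<j , fⁱx≡fʲx with toℕ i ℕ.≤? t
  ...   | no  t<i = t , ℕₚ.<-trans (ℕₚ.≰⇒> t<i) (ℕₚ.<-≤-trans i<j (ℕₚ.≤-pred (Finₚ.toℕ<n j))) , refl
  ...   | yes i≤t =
    s ℕ.% d ℕ.+ toℕ i , ℕₚ.<-≤-trans (ℕₚ.+-monoˡ-< (toℕ i) (ℕDivMod.m%n<n s d)) j≤n , (begin
      iter f t x
        ≡⟨ cong (λ e → iter f e x) t≡ ⟩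
      iter f (s ℕ.% d ℕ.+ (s ℕ./ d ℕ.* d ℕ.+ toℕ i)) x
        ≡⟨ iter-+ f (s ℕ.% d) _ x ⟩
      iter f (s ℕ.% d) (iter f (s ℕ./ d ℕ.* d ℕ.+ toℕ i) x)
        ≡⟨ cong (iter f (s ℕ.% d)) (iter-+ f (s ℕ./ d ℕ.* d) (toℕ i) x) ⟩
      iter f (s ℕ.% d) (iter f (s ℕ./ d ℕ.* d) y)
        ≡⟨ cong (iter f (s ℕ.% d)) (iter-periodic f period (s ℕ./ d)) ⟩
      iter f (s ℕ.% d) y
        ≡⟨ iter-+ f (s ℕ.% d) (toℕ i) x ⟨
      iter f (s ℕ.% d ℕ.+ toℕ i) x
        ∎)
    where
    open ≡-Reasoning
    d = toℕ j ∸ toℕ i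
    s = t ∸ toℕ i
    y = iter f (toℕ i) x
    instance _ = ℕ.>-nonZero (ℕₚ.m<n⇒0<n∸m i<j)
    j≤n : d ℕ.+ toℕ i ≤ n
    j≤n = ℕₚ.≤-trans (ℕₚ.≤-reflexive (ℕₚ.m∸n+n≡m (ℕₚ.<⇒≤ i<j))) (ℕₚ.≤-pred (Finₚ.toℕ<n j))
    period : iter f d y ≡ y
    period = trans (sym (iter-+ f d (toℕ i) x))
                   (trans (cong (λ e → iter f e x) (ℕₚ.m∸n+n≡m (ℕₚ.<⇒≤ i<j))) (sym fⁱx≡fʲx))
    t≡ : t ≡ s ℕ.% d ℕ.+ (s ℕ./ d ℕ.* d ℕ.+ toℕ i)
    t≡ = begin
      t                                             ≡⟨ ℕₚ.m∸n+n≡m i≤t ⟨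
      s ℕ.+ toℕ i                                   ≡⟨ cong (ℕ._+ toℕ i) (ℕDivMod.m≡m%n+[m/n]*n s d) ⟩
      s ℕ.% d ℕ.+ s ℕ./ d ℕ.* d ℕ.+ toℕ i           ≡⟨ ℕₚ.+-assoc (s ℕ.% d) (s ℕ./ d ℕ.* d) (toℕ i) ⟩
      s ℕ.% d ℕ.+ (s ℕ./ d ℕ.* d ℕ.+ toℕ i)         ∎

  isOrbitMin-≤ : ∀ {n} (f : Fin n → Fin n) {x} → isOrbitMin f x → ∀ t → toℕ x ≤ toℕ (iter f t x)
  isOrbitMin-≤ {n} f {x} minimal t =
    let m , m<n , fᵗx≡fᵐx = iter-below f x t
    in subst (λ y → toℕ x ≤ toℕ y) (sym fᵗx≡fᵐx) (Allₚ.applyUpTo⁻ id n minimal m<n)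

  AllPairs-lookup : ∀ {A : Set} {R : A → A → Set} {xs} → AllPairs R xs →
                    ∀ {i j} → i Fin.< j → R (List.lookup xs i) (List.lookup xs j)
  AllPairs-lookup {xs = _ ∷ _} (Rx ∷ _)   {Fin.zero}  {Fin.suc j} _         = All.lookup Rx (∈-lookup j)
  AllPairs-lookup {xs = _ ∷ _} (_ ∷ Rxs) {Fin.suc i} {Fin.suc j} (s≤s i<j) = AllPairs-lookup Rxs i<j

  -- Orbit minima with the same value of V lie in a common orbit, hence coincide.
  cyc-≤ : ∀ {n K} (f : Fin n → Fin n) (V : Fin n → Fin K) →
          (∀ {x y} → V x ≡ V y → ∃[ t ] iter f t x ≡ y) → cyc f ≤ K
  cyc-≤ {n} f V same-orbit = ℕₚ.≮⇒≥ λ K<cyc →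
    let i , j , i<j , Vxᵢ≡Vxⱼ = Finₚ.pigeonhole K<cyc (V ∘ List.lookup minima)
    in AllPairs-lookup distinct i<j (minima-equal (minimal i) (minimal j) Vxᵢ≡Vxⱼ)
    where
    minima = List.filter (isOrbitMin? f) (allFin n)
    distinct : AllPairs _≢_ minima
    distinct = Uniqueₚ.filter⁺ (isOrbitMin? f) (Uniqueₚ.allFin⁺ n)
    minimal : ∀ i → isOrbitMin f (List.lookup minima i)
    minimal i = All.lookup (Allₚ.all-filter (isOrbitMin? f) (allFin n)) (∈-lookup i)
    minima-equal : ∀ {x y} → isOrbitMin f x → isOrbitMin f y → V x ≡ V y → x ≡ y
    minima-equal {x} {y} min-x min-y Vx≡Vy =
      let s , fˢx≡y = same-orbit Vx≡Vy
          t , fᵗy≡x = same-orbit (sym Vx≡Vy)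
      in Finₚ.toℕ-injective (ℕₚ.≤-antisym (subst (λ z → toℕ x ≤ toℕ z) fˢx≡y (isOrbitMin-≤ f min-x s))
                                           (subst (λ z → toℕ y ≤ toℕ z) fᵗy≡x (isOrbitMin-≤ f min-y t)))

  -- The cosets of multiplication by a primitive root

  toℕ-mod-≡mod : ∀ {n} .⦃ _ : NonZero n ⦄ x → + toℕ (x mod n) ≡ + x [mod + n ]
  toℕ-mod-≡mod {n} x =
    subst (λ r → + r ≡ + x [mod + n ]) (sym (Finₚ.toℕ-fromℕ< _)) (≡mod-sym (≡mod-%ℕ (+ x) n))

  ≤-≡mod⇒≡ : ∀ {n} {i j : Fin n} → toℕ i ≤ toℕ j → + toℕ j ≡ + toℕ i [mod + n ] → i ≡ j
  ≤-≡mod⇒≡ {n} {i} {j} i≤j j≡i = Finₚ.toℕ-injective (ℕₚ.≤-antisym i≤j (ℕₚ.m∸n≡0⇒m≤n j-i≡0))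
    where
    instance _ = ℕ.>-nonZero (ℕₚ.≤-<-trans z≤n (Finₚ.toℕ<n j))
    n∣j-i : n ℕ∣.∣ toℕ j ∸ toℕ i
    n∣j-i = subst (n ℕ∣.∣_) (cong ℤ.∣_∣ (trans (ℤₚ.m-n≡m⊖n (toℕ j) (toℕ i)) (ℤₚ.⊖-≥ i≤j)))
                  (ℤ∣.∣⇒∣ᵤ (≡mod⇒∣ j≡i))
    j-i≡0 : toℕ j ∸ toℕ i ≡ 0
    j-i≡0 = trans (sym (ℕDivMod.m<n⇒m%n≡m (ℕₚ.≤-<-trans (ℕₚ.m∸n≤m (toℕ j) (toℕ i)) (Finₚ.toℕ<n j))))
                  (ℕ∣.n∣m⇒m%n≡0 _ n n∣j-i)

  toℕ-≡mod-injective : ∀ {n} {i j : Fin n} → + toℕ i ≡ + toℕ j [mod + n ] → i ≡ j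
  toℕ-≡mod-injective {i = i} {j} i≡j with ℕₚ.≤-total (toℕ i) (toℕ j)
  ... | inj₁ i≤j = ≤-≡mod⇒≡ i≤j (≡mod-sym i≡j)
  ... | inj₂ j≤i = sym (≤-≡mod⇒≡ j≤i i≡j)

  cpow-≡mod : ∀ {n} j (x : Fin n) → + toℕ (cpow n j x) ≡ + toℕ x + + j [mod + n ]
  cpow-≡mod {suc m} j x =
    subst (λ y → + toℕ (cpow (suc m) j x) ≡ y [mod + suc m ]) (ℤₚ.pos-+ (toℕ x) j) (toℕ-mod-≡mod (toℕ x ℕ.+ j))

  module _ {p : ℕ} (p-prime : Prime p) (k a : ℕ) (p∤a : Unit p (+ a)) (p∤a-1 : Unit p (+ a - 1ℤ))
           (prim : IsPrimitiveRoot p (+ (p ℕ.^ k)) (+ a)) where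

    private
      n : ℕ
      n = p ℕ.^ k
      N : ℤ
      N = + n
      A : ℤ
      A = + a
      instance
        n≢0 : NonZero n
        n≢0 = ℕₚ.m^n≢0 p k ⦃ prime⇒nonZero p-prime ⦄

    scale : ℕ → Fin n → Fin n
    scale c y = (c ℕ.* toℕ y) mod n

    scale-≡mod : ∀ c y → + toℕ (scale c y) ≡ + c * + toℕ y [mod N ]
    scale-≡mod c y =
      subst (λ z → + toℕ (scale c y) ≡ z [mod N ]) (ℤₚ.pos-* c (toℕ y)) (toℕ-mod-≡mod (c ℕ.* toℕ y))

    scale-inverse : ∀ {c d} → + c * + d ≡ 1ℤ [mod N ] → ∀ y → scale c (scale d y) ≡ y
    scale-inverse {c} {d} cd≡1 y = toℕ-≡mod-injective (begin
      + toℕ (scale c (scale d y))  ≈⟨ scale-≡mod c (scale d y) ⟩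
      + c * + toℕ (scale d y)      ≈⟨ *-congˡ-mod (+ c) (scale-≡mod d y) ⟩
      + c * (+ d * + toℕ y)        ≡⟨ ℤₚ.*-assoc (+ c) (+ d) (+ toℕ y) ⟨
      + c * + d * + toℕ y          ≈⟨ *-congʳ-mod (+ toℕ y) cd≡1 ⟩
      1ℤ * + toℕ y                 ≡⟨ ℤₚ.*-identityˡ (+ toℕ y) ⟩
      + toℕ y                      ∎)
      where open ≡mod-Reasoning N

    a⁻¹ : ∃[ b ] + b * A ≡ 1ℤ [mod N ]
    a⁻¹ = let t , aᵗa≡1 = prim p∤a (unit-1 p-prime)
          in a ℕ.^ t , subst (λ b → b * A ≡ 1ℤ [mod N ]) (sym (pos-^ a t)) aᵗa≡1

    π : Permutation′ n
    π = permutation (scale a) (scale b) (scale-inverse {a} {b} ab≡1) (scale-inverse {b} {a} ba≡1)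
      where
      b = proj₁ a⁻¹
      ba≡1 = proj₂ a⁻¹
      ab≡1 = subst (_≡ 1ℤ [mod N ]) (ℤₚ.*-comm (+ b) A) ba≡1

    σ : ℕ → Fin n → Fin n
    σ j = cosetElem π j

    σ-≡mod : ∀ j x → + toℕ (σ j x) ≡ A * (+ toℕ x + + j) [mod N ]
    σ-≡mod j x = ≡mod-trans (scale-≡mod a (cpow n j x)) (*-congˡ-mod A (cpow-≡mod j x))

    L : ℕ → Fin n → ℤ
    L j x = (A - 1ℤ) * + toℕ x + A * + j

    L-σ : ∀ j x → L j (σ j x) ≡ A * L j x [mod N ]
    L-σ j x = ≡mod-trans (+-cong-mod (*-congˡ-mod (A - 1ℤ) (σ-≡mod j x)) ≡mod-refl)
                        (≡mod-reflexive (conjugate A (+ toℕ x) (+ j)))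
      where
      conjugate : ∀ A x j → (A - 1ℤ) * (A * (x + j)) + A * j ≡ A * ((A - 1ℤ) * x + A * j)
      conjugate = solve-∀

    L-iter : ∀ j t x → L j (iter (σ j) t x) ≡ A ^ t * L j x [mod N ]
    L-iter j zero    x = ≡mod-reflexive (sym (ℤₚ.*-identityˡ (L j x)))
    L-iter j (suc t) x = begin
      L j (σ j (iter (σ j) t x))    ≈⟨ L-σ j (iter (σ j) t x) ⟩
      A * L j (iter (σ j) t x)      ≈⟨ *-congˡ-mod A (L-iter j t x) ⟩
      A * (A ^ t * L j x)           ≡⟨ ℤₚ.*-assoc A (A ^ t) (L j x) ⟨
      A * A ^ t * L j x             ∎
      where open ≡mod-Reasoning N

    L-injective : ∀ j {x y} → L j x ≡ L j y [mod N ] → x ≡ y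
    L-injective j Lx≡Ly =
      toℕ-≡mod-injective (*-cancelˡ-unit-mod-^ p-prime k p∤a-1 (+-cancelʳ-mod (A * + j) Lx≡Ly))

    valuation-class-transitive : ∀ {X Y e} → IsCappedValuation p k X e → IsCappedValuation p k Y e →
                                 ∃[ t ] A ^ t * + X ≡ + Y [mod N ]
    valuation-class-transitive {X} {Y} {e} (e≤k , ℕ∣.divides U X≡Upᵉ , exactˣ)
                                           (_   , ℕ∣.divides W Y≡Wpᵉ , exactʸ)
      with ℕₚ.m≤n⇒m<n∨m≡n e≤k
    ... | inj₂ refl = 0 , mod-intro (+ U - + W) (begin
      1ℤ * + X - + Y                 ≡⟨ cong₂ (λ x y → 1ℤ * x - y) (pos-*-factor U n X≡Upᵉ) (pos-*-factor W n Y≡Wpᵉ) ⟩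
      1ℤ * (+ U * N) - + W * N       ≡⟨ factor (+ U) (+ W) N ⟩
      (+ U - + W) * N                ∎)
      where
      open ≡-Reasoning
      factor : ∀ u w m → 1ℤ * (u * m) - w * m ≡ (u - w) * m
      factor = solve-∀
    ... | inj₁ e<k =
      let t , aᵗU≡W = prim (cofactor-unit {V = U} X≡Upᵉ (exactˣ e<k))
                           (cofactor-unit {V = W} Y≡Wpᵉ (exactʸ e<k))
      in t , (begin
        A ^ t * + X                  ≡⟨ cong (A ^ t *_) (pos-*-factor U (p ℕ.^ e) X≡Upᵉ) ⟩
        A ^ t * (+ U * Pᵉ)           ≡⟨ ℤₚ.*-assoc (A ^ t) (+ U) Pᵉ ⟨
        A ^ t * + U * Pᵉ             ≈⟨ *-congʳ-mod Pᵉ aᵗU≡W ⟩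
        + W * Pᵉ                     ≡⟨ pos-*-factor W (p ℕ.^ e) Y≡Wpᵉ ⟨
        + Y                          ∎)
      where
      open ≡mod-Reasoning N
      Pᵉ = + (p ℕ.^ e)
      cofactor-unit : ∀ {Z V} → Z ≡ V ℕ.* p ℕ.^ e → ¬ p ℕ.^ suc e ℕ∣.∣ Z → Unit p (+ V)
      cofactor-unit refl pᵉ⁺¹∤Z p∣V = pᵉ⁺¹∤Z (ℕ∣.*-pres-∣ (ℤ∣.∣⇒∣ᵤ p∣V) (ℕ∣.∣-refl {p ℕ.^ e}))

    V : ℕ → Fin n → Fin (suc k)
    V j x = fromℕ< (s≤s (proj₁ (proj₂ (capped-valuation p (L j x %ℕ n) k))))

    V-same-orbit : ∀ j {x y} → V j x ≡ V j y → ∃[ t ] iter (σ j) t x ≡ y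
    V-same-orbit j {x} {y} Vx≡Vy =
      let t , aᵗX≡Y = valuation-class-transitive (proj₂ vx)
                        (subst (IsCappedValuation p k (L j y %ℕ n)) (sym eₓ≡eᵧ) (proj₂ vy))
      in t , L-injective j (begin
        L j (iter (σ j) t x)      ≈⟨ L-iter j t x ⟩
        A ^ t * L j x             ≈⟨ *-congˡ-mod (A ^ t) (≡mod-%ℕ (L j x) n) ⟩
        A ^ t * + (L j x %ℕ n)    ≈⟨ aᵗX≡Y ⟩
        + (L j y %ℕ n)            ≈⟨ ≡mod-%ℕ (L j y) n ⟨
        L j y                     ∎)
      where
      open ≡mod-Reasoning N
      vx = capped-valuation p (L j x %ℕ n) k
      vy = capped-valuation p (L j y %ℕ n) k
      eₓ≡eᵧ : proj₁ vx ≡ proj₁ vy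
      eₓ≡eᵧ = trans (sym (Finₚ.toℕ-fromℕ< _)) (trans (cong toℕ Vx≡Vy) (Finₚ.toℕ-fromℕ< _))

    coset-lower-bound : t≥ (p ℕ.^ k) (p ℕ.^ k ∸ k ∸ 1)
    coset-lower-bound = π , λ j → begin
      n ∸ k ∸ 1              ≡⟨ ℕₚ.∸-+-assoc n k 1 ⟩
      n ∸ (k ℕ.+ 1)          ≡⟨ cong (n ∸_) (ℕₚ.+-comm k 1) ⟩
      n ∸ suc k              ≤⟨ ℕₚ.∸-monoʳ-≤ n (cyc-≤ (σ (toℕ j)) (V (toℕ j)) (V-same-orbit (toℕ j))) ⟩
      n ∸ cyc (σ (toℕ j))    ∎
      where open ℕₚ.≤-Reasoning

open import Defs
open import Data.Nat using (ℕ; _^_; _∸_; _≤_)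
open import Data.Nat.Primality using (Prime)
open import Data.Product using (_,_)
open import Relation.Binary.PropositionalEquality using (_≢_)
open LowerBound using (odd-prime-power-primitive-root; coset-lower-bound)

proposition3p2 : (p k : ℕ) → Prime p → p ≢ 2 → 1 ≤ k →
    t≥ (p ^ k) ((p ^ k) ∸ k ∸ 1)
proposition3p2 p k p-prime p≢2 _ =
  let a , p∤a , p∤a-1 , prim = odd-prime-power-primitive-root p-prime p≢2
  in coset-lower-bound p-prime k a p∤a p∤a-1 (prim k)
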